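{- $R(B_2, B_8) = 21$.
   Context: For graphs $G,H$, the Ramsey number $R(G,H)$ is the smallest $n$ such that every red-blue edge-coloring of $K_n$ contains a red copy of $G$ or a blue copy of $H$ (copies as subgraphs, not necessarily induced). The book $B_k$ is the graph on $k+2$ vertices consisting of an edge $uv$ together with $k$ further vertices, each adjacent exactly to $u$ and $v$. -}

module Defs where

open import Data.Nat using (ℕ; _<_)
open import Data.Fin using (Fin)
open import Data.Product using (Σ; ∃; _×_)
open import Data.Sum using (_⊎_)
open import Relation.Nullary using (¬_)
open import Relation.Binary.PropositionalEquality using (_≡_; _≢_)
open import Function.Definitions using (Injective)

data Colour : Set where
  red blue : Colour

-- A red/blue edge-colouring of K_n: a colour for each ordered pair, required
-- to be symmetric; the diagonal values are irrelevant (never used).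
Symmetric : {n : ℕ} → (Fin n → Fin n → Colour) → Set
Symmetric {n} c = ∀ (i j : Fin n) → c i j ≡ c j i

HasBook : {n : ℕ} → (Fin n → Fin n → Colour) → Colour → ℕ → Set
HasBook {n} c col k =
  Σ (Fin n) λ u → Σ (Fin n) λ v →
    u ≢ v × c u v ≡ col ×
    Σ (Fin k → Fin n) λ f →
      Injective _≡_ _≡_ f ×
      (∀ (i : Fin k) → f i ≢ u × f i ≢ v × c u (f i) ≡ col × c v (f i) ≡ col)

BookArrows : ℕ → ℕ → ℕ → Set
BookArrows n k l =
  (c : Fin n → Fin n → Colour) → Symmetric c → HasBook c red k ⊎ HasBook c blue l

IsBookRamseyNumber : ℕ → ℕ → ℕ → Set
IsBookRamseyNumber k l r = BookArrows r k l × (∀ m → m < r → ¬ BookArrows m k l)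

-- Let c colour K₂₁ with no red B₂ and no blue B₈: every red edge has at most one red
-- common neighbour and every blue edge at most seven blue ones.  Counting pairs of blue neighbours of
-- each vertex, and blue common neighbours of the ends of each red edge, gives
-- Σ (240 + 3d²) + Σ σ = 53 Σ d + Σ t, where d is the red degree, t twice the number of red triangles
-- at a vertex and σ ≥ 0 the slack in the blue condition.  Vertex by vertex the left side is at least
-- the right one except at red degree 9, whose deficit is moved to the red neighbours of degree ≤ 7
-- that every red triangle through such a vertex contains.  So everything is tight and the red graph
-- is strongly regular with parameters (21, 8, 1, 4).  No such graph exists: the red neighbourhood N
-- of a vertex v₀ is a perfect matching, every vertex of the blue neighbourhood M of v₀ meets each
-- matching edge exactly once, and hence the parity of the number of neighbours in N shared with a
-- fixed u ∈ M properly 2-colours the red graph on M; counting the common red neighbours in M of u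
-- and the other vertices of M then gives a contradiction.
--
-- Lower bound.  An explicit colouring of K₂₀ is checked to contain no red B₂ and no blue B₈.

module Submission where

open import Defs

open import Data.Bool using (if_then_else_)
open import Data.Empty using (⊥; ⊥-elim)
open import Data.Fin using (Fin; zero; suc; toℕ; fromℕ<; inject≤; _≟_)
import Data.Fin.Properties as Finₚ
open import Data.Maybe using (Maybe; just; nothing)
import Data.Maybe.Properties
open import Data.Nat using (ℕ; zero; suc; _+_; _*_; _∸_; _≤_; _<_; z≤n; s≤s; s≤s⁻¹; _≤?_; _<?_) renaming (_≟_ to _≟ℕ_)
open import Data.Nat.DivMod using (_%_; m%n<n; %-distribˡ-+; [m+kn]%n≡m%n)
open import Data.Nat.Divisibility using (_∣_; _∣?_; divides)
open import Data.Nat.Properties hiding (_≟_)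
import Algebra.Properties.Semiring.Sum +-*-semiring as Sum
open import Data.Nat.Tactic.RingSolver using (solve-∀)
open import Data.Product using (Σ-syntax; ∃; _×_; _,_; proj₁; proj₂)
open import Data.Sum using (_⊎_; inj₁; inj₂; [_,_]′) renaming (map to map-⊎)
open import Data.Vec using (Vec; []; _∷_; lookup)
open import Function using (_∘_; id)
open import Function.Definitions using (Injective)
open import Relation.Binary.PropositionalEquality
open import Relation.Nullary using (¬_; Dec; yes; no; contradiction)
open import Relation.Nullary.Decidable using (does; _×-dec_; _⊎-dec_; _→-dec_; from-yes; from-no; dec-true; dec-false)

bit-cases : ∀ {ℓ} (P : ℕ → Set ℓ) {x} → x ≤ 1 → (x ≡ 0 → P 0) → (x ≡ 1 → P 1) → P x
bit-cases P z≤n P0 _ = P0 refl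
bit-cases P (s≤s z≤n) _ P1 = P1 refl

bit² : ∀ {x} → x ≤ 1 → x * x ≡ x
bit² z≤n = refl
bit² (s≤s z≤n) = refl

bit-*-cong : ∀ {x y z} → x ≤ 1 → (x ≡ 1 → y ≡ z) → x * y ≡ x * z
bit-*-cong z≤n _ = refl
bit-*-cong (s≤s z≤n) y≡z = cong (1 *_) (y≡z refl)

bit-*-≤ : ∀ {x y} → x ≤ 1 → (x ≡ 1 → y ≤ 1) → x * y ≤ x
bit-*-≤ z≤n _ = z≤n
bit-*-≤ {y = y} (s≤s z≤n) y≤1 = ≤-trans (≤-reflexive (+-identityʳ y)) (y≤1 refl)

bit-*-≥ : ∀ {x y} → x ≤ 1 → (x ≡ 1 → 1 ≤ y) → x ≤ x * y
bit-*-≥ z≤n _ = z≤n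
bit-*-≥ {y = y} (s≤s z≤n) 1≤y = ≤-trans (1≤y refl) (≤-reflexive (sym (+-identityʳ y)))

bit-*-mono : ∀ {x y z} → x ≤ 1 → (x ≡ 1 → y ≤ z) → x * y ≤ x * z
bit-*-mono z≤n _ = z≤n
bit-*-mono (s≤s z≤n) y≤z = +-monoˡ-≤ 0 (y≤z refl)

bit-weight : ∀ {x k y} → x ≤ 1 → (x ≡ 1 → k ≡ 1) → k * (x * y) ≡ x * y
bit-weight {k = k} z≤n _ = *-zeroʳ k
bit-weight {y = y} (s≤s z≤n) k≡1 = trans (cong (_* (1 * y)) (k≡1 refl)) (*-identityˡ (1 * y))

bit-slack : ∀ {x y l} → x ≤ 1 → (x ≡ 1 → y ≤ l) → x * y + x * (l ∸ y) ≡ l * x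
bit-slack {l = l} z≤n _ = sym (*-zeroʳ l)
bit-slack {y = y} {l} (s≤s z≤n) y≤l = begin
  y + 0 + (l ∸ y + 0)  ≡⟨ cong₂ _+_ (+-identityʳ y) (+-identityʳ (l ∸ y)) ⟩
  y + (l ∸ y)          ≡⟨ m+[n∸m]≡n (y≤l refl) ⟩
  l                    ≡⟨ sym (*-identityʳ l) ⟩
  l * 1                ∎
  where open ≡-Reasoning

bits-product-zero : ∀ {x y} z → x ≤ 1 → y ≤ 1 → (x ≡ 1 → y ≡ 1 → ⊥) → x * y * z ≡ 0
bits-product-zero z z≤n _ _ = refl
bits-product-zero z (s≤s z≤n) z≤n _ = refl
bits-product-zero z (s≤s z≤n) (s≤s z≤n) not-both = ⊥-elim (not-both refl refl)

bits-product-positive : ∀ {x y} → x ≤ 1 → y ≤ 1 → 0 < x * y → x ≡ 1 × y ≡ 1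
bits-product-positive (s≤s z≤n) (s≤s z≤n) _ = refl , refl

bits-not-both : ∀ {x y} → x ≤ 1 → y ≤ 1 → (x ≡ 1 → y ≡ 1 → ⊥) → x + y ≤ 1
bits-not-both z≤n y≤1 _ = y≤1
bits-not-both (s≤s z≤n) z≤n _ = s≤s z≤n
bits-not-both (s≤s z≤n) (s≤s z≤n) not-both = ⊥-elim (not-both refl refl)

bits³-zero : ∀ {a b c} → a ≤ 1 → b ≤ 1 → c ≤ 1 → (a ≡ 1 → b ≡ 1 → c ≡ 1 → ⊥) → a * (b * c) ≡ 0
bits³-zero z≤n _ _ _ = refl
bits³-zero (s≤s z≤n) z≤n _ _ = refl
bits³-zero (s≤s z≤n) (s≤s z≤n) z≤n _ = refl
bits³-zero (s≤s z≤n) (s≤s z≤n) (s≤s z≤n) not-all = ⊥-elim (not-all refl refl refl)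

bonferroni₃ : ∀ {x y z} → x ≤ 1 → y ≤ 1 → z ≤ 1 → x + y + z ≤ 1 + x * y + x * z + y * z
bonferroni₃ z≤n z≤n z≤n = z≤n
bonferroni₃ z≤n z≤n (s≤s z≤n) = ≤-refl
bonferroni₃ z≤n (s≤s z≤n) z≤n = ≤-refl
bonferroni₃ z≤n (s≤s z≤n) (s≤s z≤n) = ≤-refl
bonferroni₃ (s≤s z≤n) z≤n z≤n = ≤-refl
bonferroni₃ (s≤s z≤n) z≤n (s≤s z≤n) = ≤-refl
bonferroni₃ (s≤s z≤n) (s≤s z≤n) z≤n = ≤-refl
bonferroni₃ (s≤s z≤n) (s≤s z≤n) (s≤s z≤n) = n≤1+n 3

-- The contribution of one matching edge in NoStronglyRegular.parity-identity: a, b, s (resp. a′, b′, s′)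
-- are the adjacencies of y, y′, u to one (resp. the other) end.
pair-parity : ∀ {a a′ b b′ s s′} → a ≤ 1 → b ≤ 1 → s ≤ 1 → a + a′ ≡ 1 → b + b′ ≡ 1 → s + s′ ≡ 1 →
  a * s + b * s + a * b + (a′ * s′ + b′ * s′ + a′ * b′) ≡ 1 + 2 * (s * (a * b) + s′ * (a′ * b′))
pair-parity z≤n z≤n z≤n refl refl refl = refl
pair-parity z≤n z≤n (s≤s z≤n) refl refl refl = refl
pair-parity z≤n (s≤s z≤n) z≤n refl refl refl = refl
pair-parity z≤n (s≤s z≤n) (s≤s z≤n) refl refl refl = refl
pair-parity (s≤s z≤n) z≤n z≤n refl refl refl = refl
pair-parity (s≤s z≤n) z≤n (s≤s z≤n) refl refl refl = refl
pair-parity (s≤s z≤n) (s≤s z≤n) z≤n refl refl refl = refl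
pair-parity (s≤s z≤n) (s≤s z≤n) (s≤s z≤n) refl refl refl = refl

odd-sum : ∀ a b k → a + b ≡ 3 + 2 * k → a % 2 + b % 2 ≡ 1
odd-sum a b k a+b≡ = bits-odd (s≤s⁻¹ (m%n<n a 2)) (s≤s⁻¹ (m%n<n b 2)) (begin
  (a % 2 + b % 2) % 2  ≡⟨ sym (%-distribˡ-+ a b 2) ⟩
  (a + b) % 2          ≡⟨ cong (_% 2) (trans a+b≡ (cong (3 +_) (*-comm 2 k))) ⟩
  (3 + k * 2) % 2      ≡⟨ [m+kn]%n≡m%n 3 k 2 ⟩
  1                    ∎)
  where
    open ≡-Reasoning
    bits-odd : ∀ {x y} → x ≤ 1 → y ≤ 1 → (x + y) % 2 ≡ 1 → x + y ≡ 1
    bits-odd z≤n z≤n ()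
    bits-odd z≤n (s≤s z≤n) _ = refl
    bits-odd (s≤s z≤n) z≤n _ = refl
    bits-odd (s≤s z≤n) (s≤s z≤n) ()

𝟙 : ∀ {a} {A : Set a} → Dec A → ℕ
𝟙 a? = if does a? then 1 else 0

module _ {a} {A : Set a} where

  𝟙-yes : (a? : Dec A) → A → 𝟙 a? ≡ 1
  𝟙-yes a? a rewrite dec-true a? a = refl

  𝟙-no : (a? : Dec A) → ¬ A → 𝟙 a? ≡ 0
  𝟙-no a? ¬a rewrite dec-false a? ¬a = refl

  𝟙≡1⇒ : (a? : Dec A) → 𝟙 a? ≡ 1 → A
  𝟙≡1⇒ (yes a) _ = a

  𝟙≤1 : (a? : Dec A) → 𝟙 a? ≤ 1
  𝟙≤1 (yes _) = s≤s z≤n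
  𝟙≤1 (no _) = z≤n

δ : ∀ {n} → Fin n → Fin n → ℕ
δ a b = 𝟙 (a ≟ b)

-- Opaque, so that type checking never unfolds a sum over Fin 21.
opaque
  ∑ : ∀ {n} → (Fin n → ℕ) → ℕ
  ∑ = Sum.sum

  ∑-cong : ∀ {n} {f g : Fin n → ℕ} → (∀ i → f i ≡ g i) → ∑ f ≡ ∑ g
  ∑-cong = Sum.sum-cong-≗

  ∑-distrib-+ : ∀ {n} (f g : Fin n → ℕ) → ∑ (λ i → f i + g i) ≡ ∑ f + ∑ g
  ∑-distrib-+ = Sum.∑-distrib-+

  ∑-comm : ∀ {m n} (f : Fin m → Fin n → ℕ) → ∑ (λ i → ∑ (f i)) ≡ ∑ (λ j → ∑ (λ i → f i j))
  ∑-comm = Sum.∑-comm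

  *-distribˡ-∑ : ∀ {n} k (f : Fin n → ℕ) → k * ∑ f ≡ ∑ (λ i → k * f i)
  *-distribˡ-∑ = Sum.*-distribˡ-sum

  *-distribʳ-∑ : ∀ {n} k (f : Fin n → ℕ) → ∑ f * k ≡ ∑ (λ i → f i * k)
  *-distribʳ-∑ = Sum.*-distribʳ-sum

  ∑-mono-≤ : ∀ {n} {f g : Fin n → ℕ} → (∀ i → f i ≤ g i) → ∑ f ≤ ∑ g
  ∑-mono-≤ {zero} f≤g = z≤n
  ∑-mono-≤ {suc n} f≤g = +-mono-≤ (f≤g zero) (∑-mono-≤ (f≤g ∘ suc))

  ∑-const : ∀ n k → ∑ {n} (λ _ → k) ≡ n * k
  ∑-const zero k = refl
  ∑-const (suc n) k = cong (k +_) (∑-const n k)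

  ∑-zero : ∀ {n} {f : Fin n → ℕ} → (∀ i → f i ≡ 0) → ∑ f ≡ 0
  ∑-zero {n} f≗0 = trans (∑-cong f≗0) (trans (∑-const n 0) (*-zeroʳ n))

  term≤∑ : ∀ {n} (f : Fin n → ℕ) i → f i ≤ ∑ f
  term≤∑ f zero = m≤m+n (f zero) _
  term≤∑ f (suc i) = ≤-trans (term≤∑ (f ∘ suc) i) (m≤n+m _ (f zero))

  two-terms≤∑ : ∀ {n} (f : Fin n → ℕ) {i j} → i ≢ j → f i + f j ≤ ∑ f
  two-terms≤∑ f {zero} {zero} i≢j = contradiction refl i≢j
  two-terms≤∑ f {zero} {suc j} _ = +-monoʳ-≤ (f zero) (term≤∑ (f ∘ suc) j)
  two-terms≤∑ f {suc i} {zero} _ =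
    ≤-trans (≤-reflexive (+-comm (f (suc i)) (f zero))) (+-monoʳ-≤ (f zero) (term≤∑ (f ∘ suc) i))
  two-terms≤∑ f {suc i} {suc j} i≢j =
    ≤-trans (two-terms≤∑ (f ∘ suc) (i≢j ∘ cong suc)) (m≤n+m _ (f zero))

  positive-term : ∀ {n} (f : Fin n → ℕ) → 0 < ∑ f → ∃ λ i → 0 < f i
  positive-term {suc n} f 0<Σ with f zero in f₀
  ... | suc _ = zero , subst (0 <_) (sym f₀) (s≤s z≤n)
  ... | zero with positive-term (f ∘ suc) 0<Σ
  ...   | i , 0<fi = suc i , 0<fi

  ∑-≡⇒pointwise-≡ : ∀ {n} {f g : Fin n → ℕ} → (∀ i → f i ≤ g i) → ∑ f ≡ ∑ g → ∀ i → f i ≡ g i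
  ∑-≡⇒pointwise-≡ {suc n} {f} {g} f≤g Σf≡Σg i = go i
    where
      tails≤ : ∑ (f ∘ suc) ≤ ∑ (g ∘ suc)
      tails≤ = ∑-mono-≤ (f≤g ∘ suc)
      head≡ : f zero ≡ g zero
      head≡ = ≤-antisym (f≤g zero)
        (+-cancelʳ-≤ (∑ (f ∘ suc)) (g zero) (f zero) (≤-trans (+-monoʳ-≤ (g zero) tails≤) (≤-reflexive (sym Σf≡Σg))))
      tails≡ : ∑ (f ∘ suc) ≡ ∑ (g ∘ suc)
      tails≡ = +-cancelˡ-≡ (f zero) _ _ (trans Σf≡Σg (cong (_+ ∑ (g ∘ suc)) (sym head≡)))
      go : ∀ i → f i ≡ g i
      go zero = head≡
      go (suc i) = ∑-≡⇒pointwise-≡ (f≤g ∘ suc) tails≡ i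

  ∑∑-symmetric-even : ∀ {n} (X : Fin n → Fin n → ℕ) → (∀ a b → X a b ≡ X b a) → (∀ a → X a a ≡ 0) →
                      2 ∣ ∑ (λ a → ∑ (λ b → X a b))
  ∑∑-symmetric-even {zero} X _ _ = divides 0 refl
  ∑∑-symmetric-even {suc n} X X-sym X-diag
    with ∑∑-symmetric-even (λ a b → X (suc a) (suc b)) (λ a b → X-sym (suc a) (suc b)) (X-diag ∘ suc)
  ... | divides k rest≡k*2 = divides (row + k) (begin
      X zero zero + row + ∑ (λ a → X (suc a) zero + ∑ (λ b → X (suc a) (suc b)))
        ≡⟨ cong₂ (λ x y → x + row + y) (X-diag zero) (∑-distrib-+ (λ a → X (suc a) zero) (λ a → ∑ (λ b → X (suc a) (suc b)))) ⟩
      row + (∑ (λ a → X (suc a) zero) + ∑ (λ a → ∑ (λ b → X (suc a) (suc b))))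
        ≡⟨ cong₂ (λ x y → row + (x + y)) (∑-cong (λ a → X-sym (suc a) zero)) rest≡k*2 ⟩
      row + (row + k * 2)
        ≡⟨ regroup row k ⟩
      (row + k) * 2 ∎)
    where
      open ≡-Reasoning
      row : ℕ
      row = ∑ (λ b → X zero (suc b))
      regroup : ∀ x y → x + (x + y * 2) ≡ (x + y) * 2
      regroup = solve-∀

  ∑-δ : ∀ {n} (f : Fin n → ℕ) x → ∑ (λ w → δ x w * f w) ≡ f x
  ∑-δ {suc n} f zero = begin
    f zero + 0 + ∑ {n} (λ _ → 0)  ≡⟨ cong₂ _+_ (+-identityʳ (f zero)) (∑-zero {n} (λ _ → refl)) ⟩
    f zero + 0                  ≡⟨ +-identityʳ (f zero) ⟩
    f zero                      ∎
    where open ≡-Reasoning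
  ∑-δ {suc n} f (suc x) = ∑-δ (f ∘ suc) x

  ∑-δ-injective≤1 : ∀ {n k} {g : Fin k → Fin n} → Injective _≡_ _≡_ g → ∀ w → ∑ (λ i → δ (g i) w) ≤ 1
  ∑-δ-injective≤1 {k = zero} g-inj w = z≤n
  ∑-δ-injective≤1 {k = suc k} {g} g-inj w with g zero ≟ w
  ... | no _ = ∑-δ-injective≤1 (Finₚ.suc-injective ∘ g-inj) w
  ... | yes refl = ≤-reflexive (cong suc (∑-zero λ i →
                     𝟙-no (g (suc i) ≟ g zero) (λ e → Finₚ.0≢1+n (sym (g-inj e)))))

  injection-from-∑ : ∀ {n} (f : Fin n → ℕ) → (∀ w → f w ≤ 1) → ∀ {k} → k ≤ ∑ f →
                       Σ[ g ∈ (Fin k → Fin n) ] Injective _≡_ _≡_ g × (∀ i → f (g i) ≡ 1)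
  injection-from-∑ {zero} f f≤1 {zero} _ = (λ ()) , (λ { {()} }) , λ ()
  injection-from-∑ {suc n} f f≤1 {k} k≤Σ with f zero in f₀
  ... | zero = let g , g-inj , fg≡1 = injection-from-∑ (f ∘ suc) (f≤1 ∘ suc) k≤Σ
               in suc ∘ g , g-inj ∘ Finₚ.suc-injective , fg≡1
  ... | suc m with k
  ...   | zero = (λ ()) , (λ { {()} }) , λ ()
  ...   | suc k = g′ , g′-inj , fg′≡1
    where
      f₀≡1 : f zero ≡ 1
      f₀≡1 = ≤-antisym (f≤1 zero) (subst (1 ≤_) (sym f₀) (s≤s z≤n))
      tail-rest : k ≤ ∑ (f ∘ suc)
      tail-rest = s≤s⁻¹ (subst (λ x → suc k ≤ x + ∑ (f ∘ suc)) (trans (sym f₀) f₀≡1) k≤Σ)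
      rest : Σ[ g ∈ (Fin k → Fin n) ] Injective _≡_ _≡_ g × (∀ i → f (suc (g i)) ≡ 1)
      rest = injection-from-∑ (f ∘ suc) (f≤1 ∘ suc) tail-rest
      g : Fin k → Fin n
      g = proj₁ rest
      g′ : Fin (suc k) → Fin (suc n)
      g′ zero = zero
      g′ (suc i) = suc (g i)
      g′-inj : Injective _≡_ _≡_ g′
      g′-inj {zero} {zero} _ = refl
      g′-inj {suc i} {suc j} e = cong suc (proj₁ (proj₂ rest) (Finₚ.suc-injective e))
      fg′≡1 : ∀ i → f (g′ i) ≡ 1
      fg′≡1 zero = f₀≡1
      fg′≡1 (suc i) = proj₂ (proj₂ rest) i

∑-ones : ∀ n → ∑ {n} (λ _ → 1) ≡ n
∑-ones n = trans (∑-const n 1) (*-identityʳ n)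

∑-distrib-+₃ : ∀ {n} (f g h : Fin n → ℕ) → ∑ (λ i → f i + g i + h i) ≡ ∑ f + ∑ g + ∑ h
∑-distrib-+₃ f g h =
  trans (∑-distrib-+ (λ i → f i + g i) h) (cong (_+ ∑ h) (∑-distrib-+ f g))

∑∑-distrib-+ : ∀ {m n} (f g : Fin m → Fin n → ℕ) →
               ∑ (λ i → ∑ (λ j → f i j + g i j)) ≡ ∑ (λ i → ∑ (f i)) + ∑ (λ i → ∑ (g i))
∑∑-distrib-+ f g = trans (∑-cong λ i → ∑-distrib-+ (f i) (g i)) (∑-distrib-+ (λ i → ∑ (f i)) (λ i → ∑ (g i)))

∑-linear : ∀ {n} k (f g : Fin n → ℕ) → ∑ (λ i → k * f i + g i) ≡ k * ∑ f + ∑ g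
∑-linear k f g = trans (∑-distrib-+ (λ i → k * f i) g) (cong (_+ ∑ g) (sym (*-distribˡ-∑ k f)))

∑-single : ∀ {n} (f : Fin n → ℕ) p → (∀ w → w ≢ p → f w ≡ 0) → ∑ f ≡ f p
∑-single f p others≡0 = trans (∑-cong pointwise) (∑-δ f p)
  where
    pointwise : ∀ w → f w ≡ δ p w * f w
    pointwise w with p ≟ w
    ... | yes refl = sym (+-identityʳ (f w))
    ... | no p≢w = others≡0 w (p≢w ∘ sym)

∑-≡⇒pointwise-≡-on : ∀ {n} {w f g : Fin n → ℕ} → (∀ i → w i ≤ 1) → (∀ i → w i ≡ 1 → f i ≤ g i) →
                     ∑ (λ i → w i * f i) ≡ ∑ (λ i → w i * g i) → ∀ i → w i ≡ 1 → f i ≡ g i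
∑-≡⇒pointwise-≡-on {w = w} {f} {g} w≤1 f≤g Σ≡Σ i wi≡1 = begin
  f i        ≡⟨ sym (*-identityˡ (f i)) ⟩
  1 * f i    ≡⟨ cong (_* f i) (sym wi≡1) ⟩
  w i * f i  ≡⟨ ∑-≡⇒pointwise-≡ (λ j → bit-*-mono (w≤1 j) (f≤g j)) Σ≡Σ i ⟩
  w i * g i  ≡⟨ cong (_* g i) wi≡1 ⟩
  1 * g i    ≡⟨ *-identityˡ (g i) ⟩
  g i        ∎
  where open ≡-Reasoning

injection≤∑ : ∀ {n k} (f : Fin n → ℕ) {g : Fin k → Fin n} →
                Injective _≡_ _≡_ g → (∀ i → 1 ≤ f (g i)) → k ≤ ∑ f
injection≤∑ {n} {k} f {g} g-inj 1≤fg = begin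
  k                                        ≡⟨ sym (∑-ones k) ⟩
  ∑ {k} (λ _ → 1)                        ≤⟨ ∑-mono-≤ 1≤fg ⟩
  ∑ (λ i → f (g i))                      ≡⟨ ∑-cong (λ i → sym (∑-δ f (g i))) ⟩
  ∑ (λ i → ∑ (λ w → δ (g i) w * f w))  ≡⟨ ∑-comm (λ i w → δ (g i) w * f w) ⟩
  ∑ (λ w → ∑ (λ i → δ (g i) w * f w))  ≡⟨ ∑-cong (λ w → sym (*-distribʳ-∑ (f w) (λ i → δ (g i) w))) ⟩
  ∑ (λ w → ∑ (λ i → δ (g i) w) * f w)  ≤⟨ ∑-mono-≤ (λ w → *-monoˡ-≤ (f w) (∑-δ-injective≤1 g-inj w)) ⟩
  ∑ (λ w → 1 * f w)                      ≡⟨ ∑-cong (λ w → *-identityˡ (f w)) ⟩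
  ∑ f                                    ∎
  where open ≤-Reasoning

_≟ᶜ_ : (x y : Colour) → Dec (x ≡ y)
red ≟ᶜ red = yes refl
red ≟ᶜ blue = no λ ()
blue ≟ᶜ red = no λ ()
blue ≟ᶜ blue = yes refl

isLoop : Maybe Colour → ℕ
isLoop nothing = 1
isLoop (just _) = 0

has : Colour → Maybe Colour → ℕ
has col nothing = 0
has col (just col′) = 𝟙 (col′ ≟ᶜ col)

has≤1 : ∀ col p → has col p ≤ 1
has≤1 col nothing = z≤n
has≤1 col (just col′) = 𝟙≤1 (col′ ≟ᶜ col)

has≡1 : ∀ {col p} → has col p ≡ 1 → p ≡ just col
has≡1 {col} {just col′} e = cong just (𝟙≡1⇒ (col′ ≟ᶜ col) e)

loop+red+blue : ∀ p → isLoop p + has red p + has blue p ≡ 1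
loop+red+blue nothing = refl
loop+red+blue (just red) = refl
loop+red+blue (just blue) = refl

*-partition : ∀ p x → x ≡ x * isLoop p + x * has red p + x * has blue p
*-partition p x = begin
  x                                                ≡⟨ sym (*-identityʳ x) ⟩
  x * 1                                            ≡⟨ cong (x *_) (sym (loop+red+blue p)) ⟩
  x * (isLoop p + has red p + has blue p)          ≡⟨ *-distribˡ-+ x _ (has blue p) ⟩
  x * (isLoop p + has red p) + x * has blue p      ≡⟨ cong (_+ x * has blue p) (*-distribˡ-+ x (isLoop p) (has red p)) ⟩
  x * isLoop p + x * has red p + x * has blue p    ∎
  where open ≡-Reasoning

-- p and q are the links from two distinct vertices u, w to a third one (see codeg-identity).
inclusion-exclusion : ∀ p q → (p ≡ nothing → q ≡ nothing → ⊥) →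
  has blue p * has blue q + has red p + has red q + (isLoop p + isLoop q) ≡
  1 + has red p * has red q + (isLoop p * has red q + isLoop q * has red p)
inclusion-exclusion nothing nothing both-loops = ⊥-elim (both-loops refl refl)
inclusion-exclusion nothing (just red) _ = refl
inclusion-exclusion nothing (just blue) _ = refl
inclusion-exclusion (just red) nothing _ = refl
inclusion-exclusion (just blue) nothing _ = refl
inclusion-exclusion (just red) (just red) _ = refl
inclusion-exclusion (just red) (just blue) _ = refl
inclusion-exclusion (just blue) (just red) _ = refl
inclusion-exclusion (just blue) (just blue) _ = refl

module Colouring {n : ℕ} (c : Fin n → Fin n → Colour) (c-sym : Symmetric c) where
  -- Opaque, so that edge col a b stays rigid and its arguments are inferred by unification.
  opaque
    link : Fin n → Fin n → Maybe Colour
    link a b = if does (a ≟ b) then nothing else just (c a b)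

    link-sym : ∀ a b → link a b ≡ link b a
    link-sym a b with a ≟ b | b ≟ a
    ... | yes _ | yes _ = refl
    ... | no _ | no _ = cong just (c-sym a b)
    ... | yes a≡b | no b≢a = contradiction (sym a≡b) b≢a
    ... | no a≢b | yes b≡a = contradiction (sym b≡a) a≢b

    link-diag : ∀ a → link a a ≡ nothing
    link-diag a rewrite dec-true (a ≟ a) refl = refl

    link-≢ : ∀ {a b} → a ≢ b → link a b ≡ just (c a b)
    link-≢ {a} {b} a≢b rewrite dec-false (a ≟ b) a≢b = refl

    link≡nothing⇒ : ∀ {a b} → link a b ≡ nothing → a ≡ b
    link≡nothing⇒ {a} {b} _ with a ≟ b
    ... | yes a≡b = a≡b

    link≡just⇒ : ∀ {a b col} → link a b ≡ just col → a ≢ b × c a b ≡ col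
    link≡just⇒ {a} {b} e with a ≟ b
    ... | no a≢b = a≢b , Data.Maybe.Properties.just-injective e

    isLoop-link : ∀ a b → isLoop (link a b) ≡ δ a b
    isLoop-link a b with a ≟ b
    ... | yes _ = refl
    ... | no _ = refl

  edge : Colour → Fin n → Fin n → ℕ
  edge col a b = has col (link a b)

  R B : Fin n → Fin n → ℕ
  R = edge red
  B = edge blue

  deg : Colour → Fin n → ℕ
  deg col v = ∑ (edge col v)

  codeg : Colour → Fin n → Fin n → ℕ
  codeg col a b = ∑ λ w → edge col a w * edge col b w

  edge-sym : ∀ col a b → edge col a b ≡ edge col b a
  edge-sym col a b = cong (has col) (link-sym a b)

  edge≤1 : ∀ col a b → edge col a b ≤ 1
  edge≤1 col a b = has≤1 col (link a b)

  edge≡1⇒ : ∀ {col a b} → edge col a b ≡ 1 → a ≢ b × c a b ≡ col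
  edge≡1⇒ {col} {a} {b} e = link≡just⇒ (has≡1 {col} {link a b} e)

  edge≡1 : ∀ {col a b} → a ≢ b → c a b ≡ col → edge col a b ≡ 1
  edge≡1 {col} {a} {b} a≢b cab≡col = trans (cong (has col) (link-≢ a≢b)) (𝟙-yes (c a b ≟ᶜ col) cab≡col)

  B≡1⇒R≡0 : ∀ {a b} → B a b ≡ 1 → R a b ≡ 0
  B≡1⇒R≡0 {a} {b} Bab≡1 = cong (has red) (has≡1 {blue} {link a b} Bab≡1)

  R≡0⇒B≡1 : ∀ {a b} → a ≢ b → R a b ≡ 0 → B a b ≡ 1
  R≡0⇒B≡1 {a} {b} a≢b Rab≡0 = begin
    B a b                              ≡⟨ sym (cong₂ (λ x y → x + y + B a b) loop≡0 Rab≡0) ⟩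
    isLoop (link a b) + R a b + B a b  ≡⟨ loop+red+blue (link a b) ⟩
    1                                  ∎
    where
      open ≡-Reasoning
      loop≡0 : isLoop (link a b) ≡ 0
      loop≡0 = trans (isLoop-link a b) (𝟙-no (a ≟ b) a≢b)

  book⇒codeg : ∀ {col k} → HasBook c col k → Σ[ a ∈ Fin n ] Σ[ b ∈ Fin n ] edge col a b ≡ 1 × k ≤ codeg col a b
  book⇒codeg (u , v , u≢v , cuv , f , f-inj , pages) =
    u , v , edge≡1 u≢v cuv , injection≤∑ _ f-inj λ i → ≤-reflexive (sym (cong₂ _*_
      (edge≡1 (proj₁ (pages i) ∘ sym) (proj₁ (proj₂ (proj₂ (pages i)))))
      (edge≡1 (proj₁ (proj₂ (pages i)) ∘ sym) (proj₂ (proj₂ (proj₂ (pages i)))))))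

  codeg⇒book : ∀ {col k a b} → edge col a b ≡ 1 → k ≤ codeg col a b → HasBook c col k
  codeg⇒book {col} {k} {a} {b} Eab≡1 k≤codeg =
    a , b , proj₁ (edge≡1⇒ Eab≡1) , proj₂ (edge≡1⇒ Eab≡1) , g , g-inj , page
    where
      common = injection-from-∑ (λ w → edge col a w * edge col b w)
                 (λ w → *-mono-≤ (edge≤1 col a w) (edge≤1 col b w)) k≤codeg
      g = proj₁ common
      g-inj = proj₁ (proj₂ common)
      page : ∀ i → g i ≢ a × g i ≢ b × c a (g i) ≡ col × c b (g i) ≡ col
      page i = proj₁ Ea≡1 ∘ sym , proj₁ Eb≡1 ∘ sym , proj₂ Ea≡1 , proj₂ Eb≡1
        where
          Ea≡1 = edge≡1⇒ (m*n≡1⇒m≡1 (edge col a (g i)) (edge col b (g i)) (proj₂ (proj₂ common) i))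
          Eb≡1 = edge≡1⇒ (m*n≡1⇒n≡1 (edge col a (g i)) (edge col b (g i)) (proj₂ (proj₂ common) i))

  ∑-loop : ∀ v f → ∑ (λ w → isLoop (link v w) * f w) ≡ f v
  ∑-loop v f = trans (∑-cong λ w → cong (_* f w) (isLoop-link v w)) (∑-δ f v)

  ∑-split : ∀ v (f : Fin n → ℕ) → ∑ f ≡ f v + ∑ (λ w → R v w * f w) + ∑ (λ w → B v w * f w)
  ∑-split v f = begin
    ∑ f
      ≡⟨ ∑-cong (λ w → sym (trans (cong (_* f w) (loop+red+blue (link v w))) (*-identityˡ (f w)))) ⟩
    ∑ (λ w → (isLoop (link v w) + R v w + B v w) * f w)
      ≡⟨ ∑-cong (λ w → trans (*-distribʳ-+ (f w) (isLoop (link v w) + R v w) (B v w))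
                                 (cong (_+ B v w * f w) (*-distribʳ-+ (f w) (isLoop (link v w)) (R v w)))) ⟩
    ∑ (λ w → isLoop (link v w) * f w + R v w * f w + B v w * f w)
      ≡⟨ ∑-distrib-+ (λ w → isLoop (link v w) * f w + R v w * f w) (λ w → B v w * f w) ⟩
    ∑ (λ w → isLoop (link v w) * f w + R v w * f w) + ∑ (λ w → B v w * f w)
      ≡⟨ cong (_+ ∑ (λ w → B v w * f w)) (∑-distrib-+ (λ w → isLoop (link v w) * f w) (λ w → R v w * f w)) ⟩
    ∑ (λ w → isLoop (link v w) * f w) + ∑ (λ w → R v w * f w) + ∑ (λ w → B v w * f w)
      ≡⟨ cong (λ x → x + ∑ (λ w → R v w * f w) + ∑ (λ w → B v w * f w)) (∑-loop v f) ⟩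
    f v + ∑ (λ w → R v w * f w) + ∑ (λ w → B v w * f w) ∎
    where open ≡-Reasoning

  deg-red+deg-blue : ∀ v → 1 + deg red v + deg blue v ≡ n
  deg-red+deg-blue v = begin
    1 + deg red v + deg blue v
      ≡⟨ sym (cong₂ (λ x y → 1 + x + y) (∑-cong (λ w → *-identityʳ (R v w))) (∑-cong (λ w → *-identityʳ (B v w)))) ⟩
    1 + ∑ (λ w → R v w * 1) + ∑ (λ w → B v w * 1)
      ≡⟨ sym (∑-split v (λ _ → 1)) ⟩
    ∑ {n} (λ _ → 1)
      ≡⟨ ∑-ones n ⟩
    n ∎
    where open ≡-Reasoning

  codeg-identity : ∀ {u w} → u ≢ w → codeg blue u w + deg red u + deg red w + 2 ≡ n + codeg red u w + (R w u + R u w)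
  codeg-identity {u} {w} u≢w = begin
    codeg blue u w + deg red u + deg red w + 2
      ≡⟨ cong (codeg blue u w + deg red u + deg red w +_) (sym (cong₂ _+_ (∑-loop-1 u) (∑-loop-1 w))) ⟩
    codeg blue u w + deg red u + deg red w + (∑ (λ v → L u v) + ∑ (λ v → L w v))
      ≡⟨ cong (codeg blue u w + deg red u + deg red w +_) (sym (∑-distrib-+ (L u) (L w))) ⟩
    codeg blue u w + deg red u + deg red w + ∑ (λ v → L u v + L w v)
      ≡⟨ cong (_+ ∑ (λ v → L u v + L w v)) (sym (∑-distrib-+₃ (λ v → B u v * B w v) (R u) (R w))) ⟩
    ∑ (λ v → B u v * B w v + R u v + R w v) + ∑ (λ v → L u v + L w v)
      ≡⟨ sym (∑-distrib-+ (λ v → B u v * B w v + R u v + R w v) (λ v → L u v + L w v)) ⟩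
    ∑ (λ v → B u v * B w v + R u v + R w v + (L u v + L w v))
      ≡⟨ ∑-cong (λ v → inclusion-exclusion (link u v) (link w v)
                         (λ p q → u≢w (trans (link≡nothing⇒ p) (sym (link≡nothing⇒ q))))) ⟩
    ∑ (λ v → 1 + R u v * R w v + (L u v * R w v + L w v * R u v))
      ≡⟨ ∑-distrib-+₃ (λ _ → 1) (λ v → R u v * R w v) (λ v → L u v * R w v + L w v * R u v) ⟩
    ∑ {n} (λ _ → 1) + codeg red u w + ∑ (λ v → L u v * R w v + L w v * R u v)
      ≡⟨ cong₂ (λ x y → x + codeg red u w + y) (∑-ones n)
               (trans (∑-distrib-+ (λ v → L u v * R w v) (λ v → L w v * R u v)) (cong₂ _+_ (∑-loop u (R w)) (∑-loop w (R u)))) ⟩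
    n + codeg red u w + (R w u + R u w) ∎
    where
      open ≡-Reasoning
      L : Fin n → Fin n → ℕ
      L a b = isLoop (link a b)
      ∑-loop-1 : ∀ a → ∑ (L a) ≡ 1
      ∑-loop-1 a = trans (∑-cong λ b → sym (*-identityʳ (L a b))) (∑-loop a (λ _ → 1))

  red-edge-codeg : ∀ {u w} → R u w ≡ 1 → codeg blue u w + deg red u + deg red w ≡ n + codeg red u w
  red-edge-codeg {u} {w} Ruw≡1 = +-cancelʳ-≡ 2 _ _ (begin
    codeg blue u w + deg red u + deg red w + 2  ≡⟨ codeg-identity (proj₁ (edge≡1⇒ Ruw≡1)) ⟩
    n + codeg red u w + (R w u + R u w)         ≡⟨ cong (λ x → n + codeg red u w + (x + R u w)) (edge-sym red w u) ⟩
    n + codeg red u w + (R u w + R u w)         ≡⟨ cong (λ x → n + codeg red u w + (x + x)) Ruw≡1 ⟩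
    n + codeg red u w + 2                       ∎)
    where open ≡-Reasoning

  blue-edge-codeg : ∀ {u w} → B u w ≡ 1 → codeg blue u w + deg red u + deg red w + 2 ≡ n + codeg red u w
  blue-edge-codeg {u} {w} Buw≡1 = begin
    codeg blue u w + deg red u + deg red w + 2  ≡⟨ codeg-identity (proj₁ (edge≡1⇒ Buw≡1)) ⟩
    n + codeg red u w + (R w u + R u w)         ≡⟨ cong (λ x → n + codeg red u w + (x + R u w)) (edge-sym red w u) ⟩
    n + codeg red u w + (R u w + R u w)         ≡⟨ cong (λ x → n + codeg red u w + (x + x)) Ruw≡0 ⟩
    n + codeg red u w + 0                       ≡⟨ +-identityʳ _ ⟩
    n + codeg red u w                           ∎
    where
      open ≡-Reasoning
      Ruw≡0 = B≡1⇒R≡0 Buw≡1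

  deg-sum≤n+codeg-sum : ∀ u v w →
    deg red u + deg red v + deg red w ≤ n + codeg red u v + codeg red u w + codeg red v w
  deg-sum≤n+codeg-sum u v w = begin
    deg red u + deg red v + deg red w
      ≡⟨ sym (∑-distrib-+₃ (R u) (R v) (R w)) ⟩
    ∑ (λ x → R u x + R v x + R w x)
      ≤⟨ ∑-mono-≤ (λ x → bonferroni₃ (edge≤1 red u x) (edge≤1 red v x) (edge≤1 red w x)) ⟩
    ∑ (λ x → 1 + R u x * R v x + R u x * R w x + R v x * R w x)
      ≡⟨ ∑-distrib-+ (λ x → 1 + R u x * R v x + R u x * R w x) (λ x → R v x * R w x) ⟩
    ∑ (λ x → 1 + R u x * R v x + R u x * R w x) + codeg red v w
      ≡⟨ cong (_+ codeg red v w) (∑-distrib-+₃ (λ _ → 1) (λ x → R u x * R v x) (λ x → R u x * R w x)) ⟩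
    ∑ {n} (λ _ → 1) + codeg red u v + codeg red u w + codeg red v w
      ≡⟨ cong (λ x → x + codeg red u v + codeg red u w + codeg red v w) (∑-ones n) ⟩
    n + codeg red u v + codeg red u w + codeg red v w ∎
    where open ≤-Reasoning

  nbhd-edges : Colour → Colour → Fin n → ℕ
  nbhd-edges col col′ v = ∑ λ a → ∑ λ b → edge col v a * edge col v b * edge col′ a b

  nbhd-edges-same : ∀ col v → nbhd-edges col col v ≡ ∑ (λ a → edge col v a * codeg col v a)
  nbhd-edges-same col v = ∑-cong λ a →
    trans (∑-cong λ b → *-assoc (edge col v a) (edge col v b) (edge col a b))
          (sym (*-distribˡ-∑ (edge col v a) (λ b → edge col v b * edge col a b)))

  nbhd-edges-even : ∀ col col′ v → 2 ∣ nbhd-edges col col′ v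
  nbhd-edges-even col col′ v = ∑∑-symmetric-even (λ a b → edge col v a * edge col v b * edge col′ a b)
    (λ a b → cong₂ _*_ (*-comm (edge col v a) _) (edge-sym col′ a b))
    (λ a → trans (cong (edge col v a * edge col v a *_) (cong (has col′) (link-diag a))) (*-zeroʳ (edge col v a * edge col v a)))

  deg²≡deg+nbhd-edges : ∀ col v → deg col v * deg col v ≡ deg col v + nbhd-edges col red v + nbhd-edges col blue v
  deg²≡deg+nbhd-edges col v = begin
    deg col v * deg col v
      ≡⟨ *-distribʳ-∑ (deg col v) (E v) ⟩
    ∑ (λ a → E v a * deg col v)
      ≡⟨ ∑-cong (λ a → *-distribˡ-∑ (E v a) (E v)) ⟩
    ∑ (λ a → ∑ (λ b → E v a * E v b))
      ≡⟨ ∑-cong (λ a → trans (∑-cong (λ b → *-partition (link a b) (E v a * E v b)))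
           (∑-distrib-+₃ (λ b → E v a * E v b * isLoop (link a b)) (λ b → E v a * E v b * R a b) (λ b → E v a * E v b * B a b))) ⟩
    ∑ (λ a → ∑ (λ b → E v a * E v b * isLoop (link a b)) + ∑ (λ b → E v a * E v b * R a b) + ∑ (λ b → E v a * E v b * B a b))
      ≡⟨ ∑-distrib-+₃ (λ a → ∑ (λ b → E v a * E v b * isLoop (link a b))) (λ a → ∑ (λ b → E v a * E v b * R a b))
                      (λ a → ∑ (λ b → E v a * E v b * B a b)) ⟩
    ∑ (λ a → ∑ (λ b → E v a * E v b * isLoop (link a b))) + nbhd-edges col red v + nbhd-edges col blue v
      ≡⟨ cong (λ x → x + nbhd-edges col red v + nbhd-edges col blue v) (∑-cong diagonal-terms) ⟩
    deg col v + nbhd-edges col red v + nbhd-edges col blue v ∎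
    where
      open ≡-Reasoning
      E = edge col
      diagonal-terms : ∀ a → ∑ (λ b → E v a * E v b * isLoop (link a b)) ≡ E v a
      diagonal-terms a = begin
        ∑ (λ b → E v a * E v b * isLoop (link a b))  ≡⟨ ∑-cong (λ b → *-comm (E v a * E v b) _) ⟩
        ∑ (λ b → isLoop (link a b) * (E v a * E v b))  ≡⟨ ∑-loop a (λ b → E v a * E v b) ⟩
        E v a * E v a                                    ≡⟨ bit² (edge≤1 col v a) ⟩
        E v a                                            ∎

  ∑-nbhd-edges : ∀ col col′ → ∑ (nbhd-edges col col′) ≡ ∑ (λ a → ∑ (λ b → edge col′ a b * codeg col a b))
  ∑-nbhd-edges col col′ = begin
    ∑ (λ v → ∑ (λ a → ∑ (λ b → E v a * E v b * edge col′ a b)))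
      ≡⟨ ∑-comm (λ v a → ∑ (λ b → E v a * E v b * edge col′ a b)) ⟩
    ∑ (λ a → ∑ (λ v → ∑ (λ b → E v a * E v b * edge col′ a b)))
      ≡⟨ ∑-cong (λ a → ∑-comm (λ v b → E v a * E v b * edge col′ a b)) ⟩
    ∑ (λ a → ∑ (λ b → ∑ (λ v → E v a * E v b * edge col′ a b)))
      ≡⟨ ∑-cong (λ a → ∑-cong (λ b → common-neighbours a b)) ⟩
    ∑ (λ a → ∑ (λ b → edge col′ a b * codeg col a b)) ∎
    where
      open ≡-Reasoning
      E = edge col
      common-neighbours : ∀ a b → ∑ (λ v → E v a * E v b * edge col′ a b) ≡ edge col′ a b * codeg col a b
      common-neighbours a b = begin
        ∑ (λ v → E v a * E v b * edge col′ a b)  ≡⟨ sym (*-distribʳ-∑ (edge col′ a b) (λ v → E v a * E v b)) ⟩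
        ∑ (λ v → E v a * E v b) * edge col′ a b  ≡⟨ cong (_* edge col′ a b)
                                                        (∑-cong λ v → cong₂ _*_ (edge-sym col v a) (edge-sym col v b)) ⟩
        codeg col a b * edge col′ a b              ≡⟨ *-comm (codeg col a b) _ ⟩
        edge col′ a b * codeg col a b              ∎

  ∑-edge-deg : ∀ col → ∑ (λ u → ∑ (λ w → edge col u w * deg col w)) ≡ ∑ (λ v → deg col v * deg col v)
  ∑-edge-deg col = begin
    ∑ (λ u → ∑ (λ w → edge col u w * deg col w))  ≡⟨ ∑-comm (λ u w → edge col u w * deg col w) ⟩
    ∑ (λ w → ∑ (λ u → edge col u w * deg col w))  ≡⟨ ∑-cong (λ w → sym (*-distribʳ-∑ (deg col w) (λ u → edge col u w))) ⟩
    ∑ (λ w → ∑ (λ u → edge col u w) * deg col w)  ≡⟨ ∑-cong (λ w → cong (_* deg col w) (∑-cong (λ u → edge-sym col u w))) ⟩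
    ∑ (λ w → deg col w * deg col w)                 ∎
    where open ≡-Reasoning

  blue-slack : ℕ → Fin n → ℕ
  blue-slack l v = ∑ λ u → B v u * (l ∸ codeg blue v u)

  nbhd-edges+slack : ∀ {l} → (∀ {a b} → B a b ≡ 1 → codeg blue a b ≤ l) →
                     ∀ v → nbhd-edges blue blue v + blue-slack l v ≡ l * deg blue v
  nbhd-edges+slack {l} blue-sparse v = begin
    nbhd-edges blue blue v + blue-slack l v
      ≡⟨ cong (_+ blue-slack l v) (nbhd-edges-same blue v) ⟩
    ∑ (λ u → B v u * codeg blue v u) + blue-slack l v
      ≡⟨ sym (∑-distrib-+ (λ u → B v u * codeg blue v u) (λ u → B v u * (l ∸ codeg blue v u))) ⟩
    ∑ (λ u → B v u * codeg blue v u + B v u * (l ∸ codeg blue v u))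
      ≡⟨ ∑-cong (λ u → bit-slack (edge≤1 blue v u) blue-sparse) ⟩
    ∑ (λ u → l * B v u)
      ≡⟨ sym (*-distribˡ-∑ l (B v)) ⟩
    l * deg blue v ∎
    where open ≡-Reasoning

  red-edge-weighted-codeg : ∀ u w → R u w * codeg blue u w + R u w * deg red u + R u w * deg red w
                                    ≡ n * R u w + R u w * codeg red u w
  red-edge-weighted-codeg u w = begin
    R u w * codeg blue u w + R u w * deg red u + R u w * deg red w  ≡⟨ sym (distrib₃ (R u w) _ _ (deg red w)) ⟩
    R u w * (codeg blue u w + deg red u + deg red w)                ≡⟨ bit-*-cong (edge≤1 red u w) red-edge-codeg ⟩
    R u w * (n + codeg red u w)                                     ≡⟨ distrib (R u w) n (codeg red u w) ⟩
    n * R u w + R u w * codeg red u w                               ∎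
    where
      open ≡-Reasoning
      distrib₃ : ∀ r a b c → r * (a + b + c) ≡ r * a + r * b + r * c
      distrib₃ = solve-∀
      distrib : ∀ r m x → r * (m + x) ≡ m * r + r * x
      distrib = solve-∀

  ∑-nbhd-edges-blue-red : ∑ (nbhd-edges blue red) + ∑ (λ v → deg red v * deg red v) + ∑ (λ v → deg red v * deg red v)
                       ≡ n * ∑ (deg red) + ∑ (nbhd-edges red red)
  ∑-nbhd-edges-blue-red = begin
    ∑ (nbhd-edges blue red) + ∑ (λ v → d v * d v) + ∑ (λ v → d v * d v)
      ≡⟨ cong₂ (λ x y → x + y + ∑ (λ v → d v * d v)) (∑-nbhd-edges blue red) (∑-cong λ u → *-distribʳ-∑ (d u) (R u)) ⟩
    ∑ (λ u → ∑ (λ w → R u w * codeg blue u w)) + ∑ (λ u → ∑ (λ w → R u w * d u)) + ∑ (λ v → d v * d v)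
      ≡⟨ cong (∑ (λ u → ∑ (λ w → R u w * codeg blue u w)) + ∑ (λ u → ∑ (λ w → R u w * d u)) +_) (sym (∑-edge-deg red)) ⟩
    ∑ (λ u → ∑ (λ w → R u w * codeg blue u w)) + ∑ (λ u → ∑ (λ w → R u w * d u)) + ∑ (λ u → ∑ (λ w → R u w * d w))
      ≡⟨ sym (∑-distrib-+₃ (λ u → ∑ (λ w → R u w * codeg blue u w)) (λ u → ∑ (λ w → R u w * d u)) (λ u → ∑ (λ w → R u w * d w))) ⟩
    ∑ (λ u → ∑ (λ w → R u w * codeg blue u w) + ∑ (λ w → R u w * d u) + ∑ (λ w → R u w * d w))
      ≡⟨ ∑-cong (λ u → sym (∑-distrib-+₃ (λ w → R u w * codeg blue u w) (λ w → R u w * d u) (λ w → R u w * d w))) ⟩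
    ∑ (λ u → ∑ (λ w → R u w * codeg blue u w + R u w * d u + R u w * d w))
      ≡⟨ ∑-cong (λ u → ∑-cong (λ w → red-edge-weighted-codeg u w)) ⟩
    ∑ (λ u → ∑ (λ w → n * R u w + R u w * codeg red u w))
      ≡⟨ ∑-cong (λ u → ∑-distrib-+ (λ w → n * R u w) (λ w → R u w * codeg red u w)) ⟩
    ∑ (λ u → ∑ (λ w → n * R u w) + ∑ (λ w → R u w * codeg red u w))
      ≡⟨ ∑-distrib-+ (λ u → ∑ (λ w → n * R u w)) (λ u → ∑ (λ w → R u w * codeg red u w)) ⟩
    ∑ (λ u → ∑ (λ w → n * R u w)) + ∑ (λ u → ∑ (λ w → R u w * codeg red u w))
      ≡⟨ cong₂ _+_ (trans (∑-cong λ u → sym (*-distribˡ-∑ n (R u))) (sym (*-distribˡ-∑ n d))) (sym (∑-nbhd-edges red red)) ⟩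
    n * ∑ d + ∑ (nbhd-edges red red) ∎
    where
      open ≡-Reasoning
      d = deg red

  record StronglyRegular (k λ′ μ : ℕ) : Set where
    field
      regular : ∀ v → deg red v ≡ k
      adjacent-codeg : ∀ {a b} → R a b ≡ 1 → codeg red a b ≡ λ′
      nonadjacent-codeg : ∀ {a b} → B a b ≡ 1 → codeg red a b ≡ μ

  module RedSparse (red-sparse : ∀ {a b} → R a b ≡ 1 → codeg red a b ≤ 1) where

    nbhd-edges≤deg : ∀ v → nbhd-edges red red v ≤ deg red v
    nbhd-edges≤deg v = ≤-trans (≤-reflexive (nbhd-edges-same red v))
      (∑-mono-≤ λ a → bit-*-≤ (edge≤1 red v a) red-sparse)

    triangle-deg-sum≤n+3 : ∀ {u v w} → R u v ≡ 1 → R u w ≡ 1 → R v w ≡ 1 → deg red u + deg red v + deg red w ≤ n + 3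
    triangle-deg-sum≤n+3 {u} {v} {w} Ruv Ruw Rvw = begin
      deg red u + deg red v + deg red w                          ≤⟨ deg-sum≤n+codeg-sum u v w ⟩
      n + codeg red u v + codeg red u w + codeg red v w          ≤⟨ +-mono-≤ (+-mono-≤ (+-monoʳ-≤ n (red-sparse Ruv)) (red-sparse Ruw))
                                                                              (red-sparse Rvw) ⟩
      n + 1 + 1 + 1                                              ≡⟨ trans (+-assoc (n + 1) 1 1) (+-assoc n 1 2) ⟩
      n + 3                                                      ∎
      where open ≤-Reasoning

-- The lower bound

restrict-book : ∀ {m n} {ι : Fin m → Fin n} → Injective _≡_ _≡_ ι → ∀ {c : Fin n → Fin n → Colour} {col k} →
                HasBook (λ i j → c (ι i) (ι j)) col k → HasBook c col k
restrict-book {ι = ι} ι-inj (u , v , u≢v , cuv , f , f-inj , pages) =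
  ι u , ι v , u≢v ∘ ι-inj , cuv , ι ∘ f , f-inj ∘ ι-inj ,
  λ i → let fi≢u , fi≢v , cufi , cvfi = pages i in fi≢u ∘ ι-inj , fi≢v ∘ ι-inj , cufi , cvfi

BookArrows-mono : ∀ {m n k l} → m ≤ n → BookArrows m k l → BookArrows n k l
BookArrows-mono {m} {n} m≤n arrows c c-sym =
  map-⊎ (restrict-book ι-inj) (restrict-book ι-inj) (arrows (λ i j → c (ι i) (ι j)) (λ i j → c-sym (ι i) (ι j)))
  where
    ι : Fin m → Fin n
    ι i = inject≤ i m≤n
    ι-inj : Injective _≡_ _≡_ ι
    ι-inj = Finₚ.inject≤-injective m≤n m≤n _ _

c₂₀-table : Vec (Vec Colour 20) 20
c₂₀-table = (blue ∷ red ∷ blue ∷ blue ∷ red ∷ red ∷ blue ∷ blue ∷ blue ∷ blue ∷ red ∷ red ∷ blue ∷ red ∷ blue ∷ blue ∷ blue ∷ red ∷ blue ∷ blue ∷ [])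
  ∷ (red ∷ blue ∷ blue ∷ red ∷ blue ∷ blue ∷ blue ∷ red ∷ blue ∷ red ∷ blue ∷ blue ∷ red ∷ blue ∷ red ∷ blue ∷ blue ∷ blue ∷ red ∷ blue ∷ [])
  ∷ (blue ∷ blue ∷ blue ∷ red ∷ blue ∷ blue ∷ blue ∷ red ∷ red ∷ blue ∷ red ∷ red ∷ blue ∷ red ∷ red ∷ blue ∷ blue ∷ blue ∷ blue ∷ blue ∷ [])
  ∷ (blue ∷ red ∷ red ∷ blue ∷ blue ∷ red ∷ red ∷ blue ∷ blue ∷ red ∷ blue ∷ red ∷ blue ∷ blue ∷ blue ∷ blue ∷ red ∷ red ∷ blue ∷ blue ∷ [])
  ∷ (red ∷ blue ∷ blue ∷ blue ∷ blue ∷ blue ∷ red ∷ red ∷ red ∷ red ∷ blue ∷ red ∷ blue ∷ blue ∷ red ∷ blue ∷ red ∷ blue ∷ blue ∷ blue ∷ [])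
  ∷ (red ∷ blue ∷ blue ∷ red ∷ blue ∷ blue ∷ red ∷ red ∷ red ∷ blue ∷ blue ∷ blue ∷ red ∷ red ∷ blue ∷ red ∷ blue ∷ blue ∷ blue ∷ blue ∷ [])
  ∷ (blue ∷ blue ∷ blue ∷ red ∷ red ∷ red ∷ blue ∷ blue ∷ blue ∷ blue ∷ red ∷ blue ∷ blue ∷ blue ∷ red ∷ blue ∷ blue ∷ blue ∷ red ∷ red ∷ [])
  ∷ (blue ∷ red ∷ red ∷ blue ∷ red ∷ red ∷ blue ∷ blue ∷ blue ∷ blue ∷ blue ∷ blue ∷ blue ∷ blue ∷ blue ∷ red ∷ red ∷ blue ∷ blue ∷ red ∷ [])
  ∷ (blue ∷ blue ∷ red ∷ blue ∷ red ∷ red ∷ blue ∷ blue ∷ blue ∷ red ∷ blue ∷ blue ∷ red ∷ blue ∷ blue ∷ blue ∷ blue ∷ red ∷ red ∷ blue ∷ [])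
  ∷ (blue ∷ red ∷ blue ∷ red ∷ red ∷ blue ∷ blue ∷ blue ∷ red ∷ blue ∷ red ∷ blue ∷ blue ∷ red ∷ blue ∷ red ∷ blue ∷ blue ∷ blue ∷ red ∷ [])
  ∷ (red ∷ blue ∷ red ∷ blue ∷ blue ∷ blue ∷ red ∷ blue ∷ blue ∷ red ∷ blue ∷ blue ∷ red ∷ blue ∷ blue ∷ red ∷ red ∷ blue ∷ blue ∷ blue ∷ [])
  ∷ (red ∷ blue ∷ red ∷ red ∷ red ∷ blue ∷ blue ∷ blue ∷ blue ∷ blue ∷ blue ∷ blue ∷ red ∷ blue ∷ blue ∷ red ∷ blue ∷ blue ∷ red ∷ red ∷ [])
  ∷ (blue ∷ red ∷ blue ∷ blue ∷ blue ∷ red ∷ blue ∷ blue ∷ red ∷ blue ∷ red ∷ red ∷ blue ∷ blue ∷ red ∷ blue ∷ red ∷ blue ∷ blue ∷ red ∷ [])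
  ∷ (red ∷ blue ∷ red ∷ blue ∷ blue ∷ red ∷ blue ∷ blue ∷ blue ∷ red ∷ blue ∷ blue ∷ blue ∷ blue ∷ red ∷ blue ∷ red ∷ blue ∷ red ∷ red ∷ [])
  ∷ (blue ∷ red ∷ red ∷ blue ∷ red ∷ blue ∷ red ∷ blue ∷ blue ∷ blue ∷ blue ∷ blue ∷ red ∷ red ∷ blue ∷ red ∷ blue ∷ red ∷ blue ∷ blue ∷ [])
  ∷ (blue ∷ blue ∷ blue ∷ blue ∷ blue ∷ red ∷ blue ∷ red ∷ blue ∷ red ∷ red ∷ red ∷ blue ∷ blue ∷ red ∷ blue ∷ blue ∷ red ∷ red ∷ blue ∷ [])
  ∷ (blue ∷ blue ∷ blue ∷ red ∷ red ∷ blue ∷ blue ∷ red ∷ blue ∷ blue ∷ red ∷ blue ∷ red ∷ red ∷ blue ∷ blue ∷ blue ∷ red ∷ red ∷ blue ∷ [])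
  ∷ (red ∷ blue ∷ blue ∷ red ∷ blue ∷ blue ∷ blue ∷ blue ∷ red ∷ blue ∷ blue ∷ blue ∷ blue ∷ blue ∷ red ∷ red ∷ red ∷ blue ∷ blue ∷ red ∷ [])
  ∷ (blue ∷ red ∷ blue ∷ blue ∷ blue ∷ blue ∷ red ∷ blue ∷ red ∷ blue ∷ blue ∷ red ∷ blue ∷ red ∷ blue ∷ red ∷ red ∷ blue ∷ blue ∷ blue ∷ [])
  ∷ (blue ∷ blue ∷ blue ∷ blue ∷ blue ∷ blue ∷ red ∷ red ∷ blue ∷ red ∷ blue ∷ red ∷ red ∷ red ∷ blue ∷ blue ∷ blue ∷ red ∷ blue ∷ blue ∷ [])
  ∷ []

c₂₀ : Fin 20 → Fin 20 → Colour
c₂₀ i j = lookup (lookup c₂₀-table i) j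

c₂₀-sym : Symmetric c₂₀
c₂₀-sym = from-yes (Finₚ.all? λ i → Finₚ.all? λ j → c₂₀ i j ≟ᶜ c₂₀ j i)

module C₂₀ = Colouring c₂₀ c₂₀-sym

opaque
  unfolding ∑ C₂₀.link

  c₂₀-red-sparse : ∀ a b → C₂₀.R a b ≡ 1 → C₂₀.codeg red a b < 2
  c₂₀-red-sparse = from-yes (Finₚ.all? λ a → Finₚ.all? λ b → (C₂₀.R a b ≟ℕ 1) →-dec (C₂₀.codeg red a b <? 2))

  c₂₀-blue-sparse : ∀ a b → C₂₀.B a b ≡ 1 → C₂₀.codeg blue a b < 8
  c₂₀-blue-sparse = from-yes (Finₚ.all? λ a → Finₚ.all? λ b → (C₂₀.B a b ≟ℕ 1) →-dec (C₂₀.codeg blue a b <? 8))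

¬BookArrows-20 : ¬ BookArrows 20 2 8
¬BookArrows-20 arrows with arrows c₂₀ c₂₀-sym
... | inj₁ red-book = let a , b , Rab≡1 , 2≤codeg = C₂₀.book⇒codeg red-book in <⇒≱ (c₂₀-red-sparse a b Rab≡1) 2≤codeg
... | inj₂ blue-book = let a , b , Bab≡1 , 8≤codeg = C₂₀.book⇒codeg blue-book in <⇒≱ (c₂₀-blue-sparse a b Bab≡1) 8≤codeg

-- Colourings of K₂₁ without red B₂ and blue B₈

∀-Fin⇒∀-≤ : ∀ {p} {P : ℕ → Set p} m → (∀ (i : Fin (suc m)) → P (toℕ i)) → ∀ k → k ≤ m → P k
∀-Fin⇒∀-≤ {P = P} m P-fin k k≤m = subst P (Finₚ.toℕ-fromℕ< (s≤s k≤m)) (P-fin (fromℕ< (s≤s k≤m)))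

goodman-arith : ∀ d → d ≤ 20 → 240 + 3 * (d * d) + (8 * (20 ∸ d) + 21 * d) ≡ (20 ∸ d) * (20 ∸ d) + 2 * (d * d) + 53 * d
goodman-arith = ∀-Fin⇒∀-≤ 20 (from-yes (Finₚ.all? λ (i : Fin 21) → let d = toℕ i in
  240 + 3 * (d * d) + (8 * (20 ∸ d) + 21 * d) ≟ℕ (20 ∸ d) * (20 ∸ d) + 2 * (d * d) + 53 * d))

degree-cases : ∀ d → d ≤ 20 → d ≡ 8 ⊎ d ≡ 9 ⊎ d ≡ 10 ⊎ 109 * d < 480 + 6 * (d * d)
degree-cases = ∀-Fin⇒∀-≤ 20 (from-yes (Finₚ.all? λ (i : Fin 21) → let d = toℕ i in
  d ≟ℕ 8 ⊎-dec d ≟ℕ 9 ⊎-dec d ≟ℕ 10 ⊎-dec 109 * d <? 480 + 6 * (d * d)))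

even≤9⇒≤8 : ∀ {t} → 2 ∣ t → t ≤ 9 → t ≤ 8
even≤9⇒≤8 {t} 2∣t t≤9 with m≤n⇒m<n∨m≡n t≤9
... | inj₁ t<9 = s≤s⁻¹ t<9
... | inj₂ refl = contradiction 2∣t (from-no (2 ∣? 9))

one-light : ∀ x y → x + y ≤ 15 → 1 ≤ 𝟙 (x ≤? 7) + 𝟙 (y ≤? 7)
one-light x y x+y≤15 = one-of (x ≤? 7) (y ≤? 7)
  where
    one-of : (x≤7? : Dec (x ≤ 7)) (y≤7? : Dec (y ≤ 7)) → 1 ≤ 𝟙 x≤7? + 𝟙 y≤7?
    one-of (yes _) _ = s≤s z≤n
    one-of (no _) (yes _) = s≤s z≤n
    one-of (no x≰7) (no y≰7) = contradiction (+-mono-≤ (≰⇒> x≰7) (≰⇒> y≰7)) (<⇒≱ (s≤s x+y≤15))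

-- What discharging uses about a vertex: its red degree d, t = nbhd-edges red red (twice its red
-- triangles), and the charge s it sends and r it receives.
record LocalBounds (d t s r : ℕ) : Set where
  field
    d≤20 : d ≤ 20
    t≤d : t ≤ d
    t-even : 2 ∣ t
    s≤t : s ≤ t
    r≤t : r ≤ t
    s≡0 : d ≢ 9 → s ≡ 0
    t≤2s : d ≡ 9 → t ≤ 2 * s
    r≡0 : 8 ≤ d → r ≡ 0

-- Twice the two sides of goodman-identity at a single vertex of red degree d, after discharging.
charge : ℕ → ℕ → ℕ → ℕ
charge d t r = 2 * (53 * d + t) + r

capacity : ℕ → ℕ → ℕ
capacity d s = 2 * (240 + 3 * (d * d)) + s

Discharged : ℕ → ℕ → ℕ → ℕ → Set
Discharged d t s r = charge d t r ≤ capacity d s × (charge d t r ≡ capacity d s → d ≡ 8 × t ≡ 8 ⊎ 9 ≤ d × 1 ≤ t)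

discharge-8 : ∀ {t s r} → LocalBounds 8 t s r → Discharged 8 t s r
discharge-8 {t} bounds rewrite LocalBounds.s≡0 bounds (λ ()) | LocalBounds.r≡0 bounds ≤-refl =
  +-monoˡ-≤ 0 (*-monoʳ-≤ 2 (+-monoʳ-≤ 424 t≤d)) ,
  λ tight → inj₁ (refl , +-cancelˡ-≡ 424 t 8 (*-cancelˡ-≡ (424 + t) 432 2 (+-cancelʳ-≡ 0 _ _ tight)))
  where open LocalBounds bounds

discharge-9 : ∀ {t s r} → LocalBounds 9 t s r → Discharged 9 t s r
discharge-9 {t} {s} bounds rewrite LocalBounds.r≡0 bounds (n≤1+n 8) = fits , λ tight → inj₂ (≤-refl , 1≤t tight)
  where
    open LocalBounds bounds
    double : ∀ t → 2 * (477 + t) + 0 ≡ 954 + 2 * t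
    double = solve-∀
    quadruple : ∀ t → 2 * (2 * t) ≡ 3 * t + t
    quadruple = solve-∀
    halve : ∀ s → 24 + 2 * s ≡ 2 * (12 + s)
    halve = solve-∀
    2t≤12+s : 2 * t ≤ 12 + s
    2t≤12+s = *-cancelˡ-≤ 2 (begin
      2 * (2 * t)   ≡⟨ quadruple t ⟩
      3 * t + t     ≤⟨ +-mono-≤ (*-monoʳ-≤ 3 (even≤9⇒≤8 t-even t≤d)) (t≤2s refl) ⟩
      24 + 2 * s    ≡⟨ halve s ⟩
      2 * (12 + s)  ∎)
      where open ≤-Reasoning
    fits : charge 9 t 0 ≤ capacity 9 s
    fits = begin
      2 * (477 + t) + 0  ≡⟨ double t ⟩
      954 + 2 * t        ≤⟨ +-monoʳ-≤ 954 2t≤12+s ⟩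
      966 + s            ∎
      where open ≤-Reasoning
    1≤t : charge 9 t 0 ≡ capacity 9 s → 1 ≤ t
    1≤t tight = n≢0⇒n>0 λ t≡0 → <⇒≢ (≤-trans (m≤m+n 955 11) (m≤m+n 966 s))
                  (subst (λ x → charge 9 x 0 ≡ capacity 9 s) t≡0 tight)

discharge-10 : ∀ {t s r} → LocalBounds 10 t s r → Discharged 10 t s r
discharge-10 {t} bounds rewrite LocalBounds.s≡0 bounds (λ ()) | LocalBounds.r≡0 bounds (m≤m+n 8 2) =
  +-monoˡ-≤ 0 (*-monoʳ-≤ 2 (+-monoʳ-≤ 530 t≤d)) ,
  λ tight → inj₂ (n≤1+n 9 , subst (1 ≤_)
    (sym (+-cancelˡ-≡ 530 t 10 (*-cancelˡ-≡ (530 + t) 540 2 (+-cancelʳ-≡ 0 _ _ tight)))) (s≤s z≤n))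
  where open LocalBounds bounds

discharge-strict : ∀ {d t s r} → LocalBounds d t s r → 109 * d < 480 + 6 * (d * d) → charge d t r < capacity d s
discharge-strict {d} {t} {s} {r} bounds 109d< = begin-strict
  2 * (53 * d + t) + r             ≤⟨ +-mono-≤ (*-monoʳ-≤ 2 (+-monoʳ-≤ (53 * d) t≤d)) (≤-trans r≤t t≤d) ⟩
  2 * (53 * d + d) + d             ≡⟨ linear d ⟩
  109 * d                          <⟨ 109d< ⟩
  480 + 6 * (d * d)                ≡⟨ quadratic (d * d) ⟩
  2 * (240 + 3 * (d * d))          ≤⟨ m≤m+n _ s ⟩
  2 * (240 + 3 * (d * d)) + s      ∎
  where
    open LocalBounds bounds
    open ≤-Reasoning
    linear : ∀ d → 2 * (53 * d + d) + d ≡ 109 * d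
    linear = solve-∀
    quadratic : ∀ x → 480 + 6 * x ≡ 2 * (240 + 3 * x)
    quadratic = solve-∀

discharge : ∀ {d t s r} → LocalBounds d t s r → Discharged d t s r
discharge {d} bounds with degree-cases d (LocalBounds.d≤20 bounds)
... | inj₁ refl = discharge-8 bounds
... | inj₂ (inj₁ refl) = discharge-9 bounds
... | inj₂ (inj₂ (inj₁ refl)) = discharge-10 bounds
... | inj₂ (inj₂ (inj₂ 109d<)) = <⇒≤ strict , λ tight → contradiction tight (<⇒≢ strict)
  where strict = discharge-strict bounds 109d<

module BookFree₂₁ (c : Fin 21 → Fin 21 → Colour) (c-sym : Symmetric c) where
  open Colouring c c-sym

  module _ (red-sparse : ∀ {a b} → R a b ≡ 1 → codeg red a b ≤ 1)
           (blue-sparse : ∀ {a b} → B a b ≡ 1 → codeg blue a b ≤ 7) where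
    open RedSparse red-sparse

    private
      d t ρ σ : Fin 21 → ℕ
      d = deg red
      t = nbhd-edges red red
      ρ = nbhd-edges blue red
      σ = blue-slack 7

    d+deg-blue≡20 : ∀ v → d v + deg blue v ≡ 20
    d+deg-blue≡20 v = suc-injective (trans (sym (+-assoc 1 (d v) _)) (deg-red+deg-blue v))

    d≤20 : ∀ v → d v ≤ 20
    d≤20 v = subst (d v ≤_) (d+deg-blue≡20 v) (m≤m+n (d v) (deg blue v))

    deg-blue≡20∸d : ∀ v → deg blue v ≡ 20 ∸ d v
    deg-blue≡20∸d v = trans (sym (m+n∸m≡n (d v) (deg blue v))) (cong (_∸ d v) (d+deg-blue≡20 v))

    deg-blue² : ∀ v → deg blue v * deg blue v + σ v ≡ 8 * deg blue v + ρ v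
    deg-blue² v = begin
      bd * bd + σ v                              ≡⟨ cong (_+ σ v) (deg²≡deg+nbhd-edges blue v) ⟩
      bd + ρ v + nbhd-edges blue blue v + σ v    ≡⟨ +-assoc (bd + ρ v) _ (σ v) ⟩
      bd + ρ v + (nbhd-edges blue blue v + σ v)  ≡⟨ cong (bd + ρ v +_) (nbhd-edges+slack blue-sparse v) ⟩
      bd + ρ v + 7 * bd                          ≡⟨ regroup bd (ρ v) ⟩
      8 * bd + ρ v                               ∎
      where
        open ≡-Reasoning
        bd = deg blue v
        regroup : ∀ b r → b + r + 7 * b ≡ 8 * b + r
        regroup = solve-∀

    -- deg-blue² with deg blue v = 20 ∸ d v; the ρ terms cancel globally by ∑-nbhd-edges-blue-red.
    vertex-identity : ∀ v → 240 + 3 * (d v * d v) + σ v + 21 * d v ≡ 2 * (d v * d v) + 53 * d v + ρ v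
    vertex-identity v = +-cancelʳ-≡ (bd * bd + 8 * bd) _ _ (begin
      A + σ v + 21 * d v + (bd * bd + 8 * bd)            ≡⟨ shuffle₁ A (σ v) (21 * d v) (bd * bd) (8 * bd) ⟩
      A + (8 * bd + 21 * d v) + (bd * bd + σ v)          ≡⟨ cong₂ _+_ arith (deg-blue² v) ⟩
      bd * bd + D + 53 * d v + (8 * bd + ρ v)            ≡⟨ shuffle₂ (bd * bd) D (53 * d v) (8 * bd) (ρ v) ⟩
      D + 53 * d v + ρ v + (bd * bd + 8 * bd)            ∎)
      where
        open ≡-Reasoning
        bd = deg blue v
        A = 240 + 3 * (d v * d v)
        D = 2 * (d v * d v)
        arith : A + (8 * bd + 21 * d v) ≡ bd * bd + D + 53 * d v
        arith = subst (λ b → A + (8 * b + 21 * d v) ≡ b * b + D + 53 * d v) (sym (deg-blue≡20∸d v))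
                  (goodman-arith (d v) (d≤20 v))
        shuffle₁ : ∀ a s x y z → a + s + x + (y + z) ≡ a + (z + x) + (y + s)
        shuffle₁ = solve-∀
        shuffle₂ : ∀ y q e z r → y + q + e + (z + r) ≡ q + e + r + (y + z)
        shuffle₂ = solve-∀

    goodman-identity : ∑ (λ v → 240 + 3 * (d v * d v)) + ∑ σ ≡ 53 * ∑ d + ∑ t
    goodman-identity = +-cancelʳ-≡ (21 * ∑ d) _ _ (begin
      ∑ (λ v → 240 + 3 * (d v * d v)) + ∑ σ + 21 * ∑ d
        ≡⟨ cong (∑ (λ v → 240 + 3 * (d v * d v)) + ∑ σ +_) (*-distribˡ-∑ 21 d) ⟩
      ∑ (λ v → 240 + 3 * (d v * d v)) + ∑ σ + ∑ (λ v → 21 * d v)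
        ≡⟨ sym (∑-distrib-+₃ (λ v → 240 + 3 * (d v * d v)) σ (λ v → 21 * d v)) ⟩
      ∑ (λ v → 240 + 3 * (d v * d v) + σ v + 21 * d v)
        ≡⟨ ∑-cong vertex-identity ⟩
      ∑ (λ v → 2 * (d v * d v) + 53 * d v + ρ v)
        ≡⟨ ∑-distrib-+₃ (λ v → 2 * (d v * d v)) (λ v → 53 * d v) ρ ⟩
      ∑ (λ v → 2 * (d v * d v)) + ∑ (λ v → 53 * d v) + ∑ ρ
        ≡⟨ cong₂ (λ x y → x + y + ∑ ρ) (sym (*-distribˡ-∑ 2 (λ v → d v * d v))) (sym (*-distribˡ-∑ 53 d)) ⟩
      2 * Sd² + 53 * ∑ d + ∑ ρ
        ≡⟨ regroup Sd² (53 * ∑ d) (∑ ρ) ⟩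
      53 * ∑ d + (∑ ρ + Sd² + Sd²)
        ≡⟨ cong (53 * ∑ d +_) ∑-nbhd-edges-blue-red ⟩
      53 * ∑ d + (21 * ∑ d + ∑ t)
        ≡⟨ +-comm-middle (53 * ∑ d) (21 * ∑ d) (∑ t) ⟩
      53 * ∑ d + ∑ t + 21 * ∑ d ∎)
      where
        open ≡-Reasoning
        Sd² = ∑ (λ v → d v * d v)
        regroup : ∀ q x r → 2 * q + x + r ≡ x + (r + q + q)
        regroup = solve-∀
        +-comm-middle : ∀ x y z → x + (y + z) ≡ x + z + y
        +-comm-middle = solve-∀

    triangle : Fin 21 → Fin 21 → Fin 21 → ℕ
    triangle v a b = R v a * R v b * R a b

    triangle≤1 : ∀ v a b → triangle v a b ≤ 1
    triangle≤1 v a b = *-mono-≤ (*-mono-≤ (edge≤1 red v a) (edge≤1 red v b)) (edge≤1 red a b)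

    triangle-swap : ∀ v a b → triangle v a b ≡ triangle v b a
    triangle-swap v a b = cong₂ _*_ (*-comm (R v a) (R v b)) (edge-sym red a b)

    triangle-rotate : ∀ v a b → triangle v a b ≡ triangle a v b
    triangle-rotate v a b = begin
      R v a * R v b * R a b  ≡⟨ cong₂ (λ x y → x * R v b * y) (edge-sym red v a) (edge-sym red a b) ⟩
      R a v * R v b * R b a  ≡⟨ *-assoc (R a v) (R v b) (R b a) ⟩
      R a v * (R v b * R b a)  ≡⟨ cong (R a v *_) (trans (*-comm (R v b) (R b a)) (cong (_* R v b) (edge-sym red b a))) ⟩
      R a v * (R a b * R v b)  ≡⟨ sym (*-assoc (R a v) (R a b) (R v b)) ⟩
      R a v * R a b * R v b  ∎
      where open ≡-Reasoning

    triangle≡1⇒edges : ∀ {v a b} → triangle v a b ≡ 1 → R v a ≡ 1 × R v b ≡ 1 × R a b ≡ 1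
    triangle≡1⇒edges {v} {a} {b} T≡1 =
      m*n≡1⇒m≡1 (R v a) (R v b) Rva*Rvb≡1 , m*n≡1⇒n≡1 (R v a) (R v b) Rva*Rvb≡1 , m*n≡1⇒n≡1 (R v a * R v b) (R a b) T≡1
      where
        Rva*Rvb≡1 = m*n≡1⇒m≡1 (R v a * R v b) (R a b) T≡1

    -- Discharging: only vertices of red degree 9 may have charge above capacity (see discharge); they
    -- pass the excess to the light vertices that all their red triangles contain (heavy-triangle).
    light : Fin 21 → ℕ
    light a = 𝟙 (d a ≤? 7)

    transfer : Fin 21 → Fin 21 → ℕ
    transfer v a = 𝟙 (d v ≟ℕ 9) * light a * ∑ (triangle v a)

    sent received : Fin 21 → ℕ
    sent v = ∑ (transfer v)
    received a = ∑ (λ v → transfer v a)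

    transfer≤ : ∀ v a → transfer v a ≤ ∑ (triangle v a)
    transfer≤ v a = ≤-trans (*-monoˡ-≤ (∑ (triangle v a)) (*-mono-≤ (𝟙≤1 (d v ≟ℕ 9)) (𝟙≤1 (d a ≤? 7))))
                            (≤-reflexive (+-identityʳ (∑ (triangle v a))))

    sent≤t : ∀ v → sent v ≤ t v
    sent≤t v = ∑-mono-≤ (transfer≤ v)

    received≤t : ∀ a → received a ≤ t a
    received≤t a = ≤-trans (∑-mono-≤ (λ v → transfer≤ v a))
                           (≤-reflexive (∑-cong λ v → ∑-cong λ b → triangle-rotate v a b))

    sent≡0 : ∀ v → d v ≢ 9 → sent v ≡ 0
    sent≡0 v dv≢9 = ∑-zero λ a → cong (λ x → x * light a * ∑ (triangle v a)) (𝟙-no (d v ≟ℕ 9) dv≢9)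

    received≡0 : ∀ a → 8 ≤ d a → received a ≡ 0
    received≡0 a 8≤da = ∑-zero λ v → begin
      𝟙 (d v ≟ℕ 9) * light a * ∑ (triangle v a)  ≡⟨ cong (λ x → 𝟙 (d v ≟ℕ 9) * x * ∑ (triangle v a)) (𝟙-no (d a ≤? 7) (<⇒≱ 8≤da)) ⟩
      𝟙 (d v ≟ℕ 9) * 0 * ∑ (triangle v a)        ≡⟨ cong (_* ∑ (triangle v a)) (*-zeroʳ (𝟙 (d v ≟ℕ 9))) ⟩
      0                                     ∎
      where open ≡-Reasoning

    heavy-triangle : ∀ {v a b} → d v ≡ 9 → triangle v a b ≡ 1 → 1 ≤ light a + light b
    heavy-triangle {v} {a} {b} dv≡9 T≡1 = one-light (d a) (d b) (+-cancelˡ-≤ 9 _ _ (begin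
      9 + (d a + d b)      ≡⟨ cong (_+ (d a + d b)) (sym dv≡9) ⟩
      d v + (d a + d b)    ≡⟨ sym (+-assoc (d v) (d a) (d b)) ⟩
      d v + d a + d b      ≤⟨ triangle-deg-sum≤n+3 Rva Rvb Rab ⟩
      24                   ∎))
      where
        open ≤-Reasoning
        Rva = proj₁ (triangle≡1⇒edges T≡1)
        Rvb = proj₁ (proj₂ (triangle≡1⇒edges T≡1))
        Rab = proj₂ (proj₂ (triangle≡1⇒edges T≡1))

    t≤2*sent : ∀ v → d v ≡ 9 → t v ≤ 2 * sent v
    t≤2*sent v dv≡9 = begin
      t v
        ≤⟨ ∑-mono-≤ (λ a → ∑-mono-≤ (λ b → split a b)) ⟩
      ∑ (λ a → ∑ (λ b → triangle v a b * light a + triangle v a b * light b))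
        ≡⟨ ∑∑-distrib-+ (λ a b → triangle v a b * light a) (λ a b → triangle v a b * light b) ⟩
      S + ∑ (λ a → ∑ (λ b → triangle v a b * light b))
        ≡⟨ cong (S +_) (trans (∑-comm (λ a b → triangle v a b * light b))
                              (∑-cong λ b → ∑-cong λ a → cong (_* light b) (triangle-swap v a b))) ⟩
      S + S
        ≡⟨ cong (S +_) (sym (+-identityʳ S)) ⟩
      2 * S
        ≡⟨ cong (2 *_) (∑-cong λ a → trans (sym (*-distribʳ-∑ (light a) (triangle v a))) (*-comm (∑ (triangle v a)) (light a))) ⟩
      2 * ∑ (λ a → light a * ∑ (triangle v a))
        ≡⟨ cong (2 *_) (∑-cong λ a → cong (_* ∑ (triangle v a))
             (trans (sym (*-identityˡ (light a))) (cong (_* light a) (sym (𝟙-yes (d v ≟ℕ 9) dv≡9))))) ⟩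
      2 * sent v ∎
      where
        open ≤-Reasoning
        S = ∑ (λ a → ∑ (λ b → triangle v a b * light a))
        split : ∀ a b → triangle v a b ≤ triangle v a b * light a + triangle v a b * light b
        split a b = ≤-trans (bit-*-≥ (triangle≤1 v a b) (heavy-triangle dv≡9))
                            (≤-reflexive (*-distribˡ-+ (triangle v a b) (light a) (light b)))

    bounds : ∀ v → LocalBounds (d v) (t v) (sent v) (received v)
    bounds v = record
      { d≤20 = d≤20 v ; t≤d = nbhd-edges≤deg v ; t-even = nbhd-edges-even red red v
      ; s≤t = sent≤t v ; r≤t = received≤t v
      ; s≡0 = sent≡0 v ; t≤2s = t≤2*sent v ; r≡0 = received≡0 v }

    ∑-charge : ∑ (λ v → charge (d v) (t v) (received v)) ≡ ∑ (λ v → capacity (d v) (sent v)) + 2 * ∑ σ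
    ∑-charge = begin
      ∑ (λ v → 2 * (53 * d v + t v) + received v)
        ≡⟨ ∑-linear 2 (λ v → 53 * d v + t v) received ⟩
      2 * ∑ (λ v → 53 * d v + t v) + ∑ received
        ≡⟨ cong₂ (λ x y → 2 * x + y) (∑-linear 53 d t) (sym (∑-comm transfer)) ⟩
      2 * (53 * ∑ d + ∑ t) + ∑ sent
        ≡⟨ cong (λ x → 2 * x + ∑ sent) (sym goodman-identity) ⟩
      2 * (∑ (λ v → 240 + 3 * (d v * d v)) + ∑ σ) + ∑ sent
        ≡⟨ regroup (∑ (λ v → 240 + 3 * (d v * d v))) (∑ σ) (∑ sent) ⟩
      2 * ∑ (λ v → 240 + 3 * (d v * d v)) + ∑ sent + 2 * ∑ σ
        ≡⟨ cong (_+ 2 * ∑ σ) (sym (∑-linear 2 (λ v → 240 + 3 * (d v * d v)) sent)) ⟩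
      ∑ (λ v → capacity (d v) (sent v)) + 2 * ∑ σ ∎
      where
        open ≡-Reasoning
        regroup : ∀ x y z → 2 * (x + y) + z ≡ 2 * x + z + 2 * y
        regroup = solve-∀

    charge≤capacity : ∀ v → charge (d v) (t v) (received v) ≤ capacity (d v) (sent v)
    charge≤capacity v = proj₁ (discharge (bounds v))

    slack-free : ∑ σ ≡ 0
    slack-free = *-cancelˡ-≡ (∑ σ) 0 2 (n≤0⇒n≡0 (+-cancelˡ-≤ (∑ capacities) _ 0 (begin
      ∑ capacities + 2 * ∑ σ                       ≡⟨ sym ∑-charge ⟩
      ∑ (λ v → charge (d v) (t v) (received v))    ≤⟨ ∑-mono-≤ charge≤capacity ⟩
      ∑ capacities                                 ≡⟨ sym (+-identityʳ _) ⟩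
      ∑ capacities + 0                             ∎)))
      where
        open ≤-Reasoning
        capacities : Fin 21 → ℕ
        capacities v = capacity (d v) (sent v)

    tight : ∀ v → charge (d v) (t v) (received v) ≡ capacity (d v) (sent v)
    tight = ∑-≡⇒pointwise-≡ charge≤capacity (begin
      ∑ (λ v → charge (d v) (t v) (received v))  ≡⟨ ∑-charge ⟩
      ∑ (λ v → capacity (d v) (sent v)) + 2 * ∑ σ  ≡⟨ cong (λ x → ∑ (λ v → capacity (d v) (sent v)) + 2 * x) slack-free ⟩
      ∑ (λ v → capacity (d v) (sent v)) + 0  ≡⟨ +-identityʳ _ ⟩
      ∑ (λ v → capacity (d v) (sent v)) ∎)
      where open ≡-Reasoning

    tight-cases : ∀ v → d v ≡ 8 × t v ≡ 8 ⊎ 9 ≤ d v × 1 ≤ t v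
    tight-cases v = proj₂ (discharge (bounds v)) (tight v)

    8≤d : ∀ v → 8 ≤ d v
    8≤d v = [ (λ (dv≡8 , _) → ≤-reflexive (sym dv≡8)) , (λ (9≤dv , _) → ≤-trans (n≤1+n 8) 9≤dv) ]′
              (tight-cases v)

    no-heavy-triangle : ∀ v → 9 ≤ d v → 1 ≤ t v → ⊥
    no-heavy-triangle v 9≤dv 1≤tv = <⇒≱ (begin-strict
      24                    <⟨ n<1+n 24 ⟩
      9 + 8 + 8             ≤⟨ +-mono-≤ (+-mono-≤ 9≤dv (8≤d a)) (8≤d b) ⟩
      d v + d a + d b       ∎) (triangle-deg-sum≤n+3 Rva Rvb Rab)
      where
        open ≤-Reasoning
        a-row = positive-term (λ a → ∑ (triangle v a)) 1≤tv
        a = proj₁ a-row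
        b-entry = positive-term (triangle v a) (proj₂ a-row)
        b = proj₁ b-entry
        edges = triangle≡1⇒edges (≤-antisym (triangle≤1 v a b) (proj₂ b-entry))
        Rva = proj₁ edges
        Rvb = proj₁ (proj₂ edges)
        Rab = proj₂ (proj₂ edges)

    regular : ∀ v → d v ≡ 8 × t v ≡ 8
    regular v = [ id , (λ (9≤dv , 1≤tv) → ⊥-elim (no-heavy-triangle v 9≤dv 1≤tv)) ]′ (tight-cases v)

    red-codeg≡1 : ∀ {a b} → R a b ≡ 1 → codeg red a b ≡ 1
    red-codeg≡1 {a} {b} Rab≡1 = begin
      codeg red a b              ≡⟨ sym (*-identityˡ (codeg red a b)) ⟩
      1 * codeg red a b          ≡⟨ cong (_* codeg red a b) (sym Rab≡1) ⟩
      R a b * codeg red a b      ≡⟨ ∑-≡⇒pointwise-≡ (λ x → bit-*-≤ (edge≤1 red a x) red-sparse) t≡d b ⟩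
      R a b                      ≡⟨ Rab≡1 ⟩
      1                          ∎
      where
        open ≡-Reasoning
        t≡d : ∑ (λ x → R a x * codeg red a x) ≡ d a
        t≡d = trans (sym (nbhd-edges-same red a)) (trans (proj₂ (regular a)) (sym (proj₁ (regular a))))

    blue-codeg≡7 : ∀ {a b} → B a b ≡ 1 → codeg blue a b ≡ 7
    blue-codeg≡7 {a} {b} Bab≡1 = ≤-antisym (blue-sparse Bab≡1) (m∸n≡0⇒m≤n (begin
      7 ∸ codeg blue a b              ≡⟨ sym (*-identityˡ _) ⟩
      1 * (7 ∸ codeg blue a b)        ≡⟨ cong (_* (7 ∸ codeg blue a b)) (sym Bab≡1) ⟩
      B a b * (7 ∸ codeg blue a b)    ≡⟨ n≤0⇒n≡0 (≤-trans (term≤∑ (λ x → B a x * (7 ∸ codeg blue a x)) b) σa≤0) ⟩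
      0                               ∎))
      where
        open ≡-Reasoning
        σa≤0 : σ a ≤ 0
        σa≤0 = ≤-trans (term≤∑ σ a) (≤-reflexive slack-free)

    strongly-regular : StronglyRegular 8 1 4
    strongly-regular = record
      { regular = proj₁ ∘ regular
      ; adjacent-codeg = red-codeg≡1
      ; nonadjacent-codeg = λ {a} {b} Bab≡1 → +-cancelˡ-≡ 21 _ _ (sym (begin
          7 + 8 + 8 + 2                                       ≡⟨ cong₂ (λ x y → x + y + 2)
                                                                   (cong₂ _+_ (sym (blue-codeg≡7 Bab≡1)) (sym (proj₁ (regular a))))
                                                                   (sym (proj₁ (regular b))) ⟩
          codeg blue a b + d a + d b + 2                      ≡⟨ blue-edge-codeg Bab≡1 ⟩
          21 + codeg red a b                                  ∎)) }
      where open ≡-Reasoning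

-- No strongly regular graph with parameters (21, 8, 1, 4)

module NoStronglyRegular (c : Fin 21 → Fin 21 → Colour) (c-sym : Symmetric c) where
  open Colouring c c-sym

  module _ (srg : StronglyRegular 8 1 4) where
    open StronglyRegular srg

    common-neighbour-unique : ∀ {x p a b} → R x p ≡ 1 → R x a ≡ 1 → R p a ≡ 1 → R x b ≡ 1 → R p b ≡ 1 → a ≡ b
    common-neighbour-unique {x} {p} {a} {b} Rxp Rxa Rpa Rxb Rpb with a ≟ b
    ... | yes a≡b = a≡b
    ... | no a≢b = contradiction (begin
      2                                  ≡⟨ sym (cong₂ _+_ (cong₂ _*_ Rxa Rpa) (cong₂ _*_ Rxb Rpb)) ⟩
      R x a * R p a + R x b * R p b      ≤⟨ two-terms≤∑ (λ w → R x w * R p w) a≢b ⟩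
      codeg red x p                      ≡⟨ adjacent-codeg Rxp ⟩
      1                                  ∎) λ { (s≤s ()) }
      where open ≤-Reasoning

    v₀ : Fin 21
    v₀ = zero

    N M : Fin 21 → ℕ
    N = R v₀
    M = B v₀

    M⇒≢v₀ : ∀ {y} → M y ≡ 1 → v₀ ≢ y
    M⇒≢v₀ My≡1 = proj₁ (edge≡1⇒ My≡1)

    M⇒R-v₀≡0 : ∀ {y} → M y ≡ 1 → R y v₀ ≡ 0
    M⇒R-v₀≡0 {y} My≡1 = trans (edge-sym red y v₀) (B≡1⇒R≡0 My≡1)

    N-degree : ∀ {y} → M y ≡ 1 → ∑ (λ x → N x * R y x) ≡ 4
    N-degree = nonadjacent-codeg

    M-degree : ∀ {y} → M y ≡ 1 → ∑ (λ w → M w * R y w) ≡ 4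
    M-degree {y} My≡1 = +-cancelˡ-≡ 4 _ _ (begin
      4 + ∑ (λ w → M w * R y w)
        ≡⟨ cong₂ (λ x z → x + z + ∑ (λ w → M w * R y w)) (sym (M⇒R-v₀≡0 My≡1)) (sym (N-degree My≡1)) ⟩
      R y v₀ + ∑ (λ w → N w * R y w) + ∑ (λ w → M w * R y w)
        ≡⟨ sym (∑-split v₀ (R y)) ⟩
      deg red y
        ≡⟨ regular y ⟩
      8 ∎)
      where open ≡-Reasoning

    -- For x ∈ N, the value of G at the unique red neighbour of x in N (mate-at).
    mate : (Fin 21 → ℕ) → Fin 21 → ℕ
    mate G x = ∑ λ w → R x w * N w * G w

    ∑-mate : ∀ G → ∑ (λ x → N x * mate G x) ≡ ∑ (λ x → N x * G x)
    ∑-mate G = begin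
      ∑ (λ x → N x * ∑ (λ w → R x w * N w * G w))
        ≡⟨ ∑-cong (λ x → *-distribˡ-∑ (N x) (λ w → R x w * N w * G w)) ⟩
      ∑ (λ x → ∑ (λ w → N x * (R x w * N w * G w)))
        ≡⟨ ∑-comm (λ x w → N x * (R x w * N w * G w)) ⟩
      ∑ (λ w → ∑ (λ x → N x * (R x w * N w * G w)))
        ≡⟨ ∑-cong (λ w → ∑-cong (λ x → regroup (N x) (R x w) (N w) (G w))) ⟩
      ∑ (λ w → ∑ (λ x → N x * R x w * (N w * G w)))
        ≡⟨ ∑-cong (λ w → sym (*-distribʳ-∑ (N w * G w) (λ x → N x * R x w))) ⟩
      ∑ (λ w → ∑ (λ x → N x * R x w) * (N w * G w))
        ≡⟨ ∑-cong (λ w → bit-weight (edge≤1 red v₀ w) (λ Nw≡1 →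
             trans (∑-cong λ x → cong (N x *_) (edge-sym red x w)) (adjacent-codeg Nw≡1))) ⟩
      ∑ (λ w → N w * G w) ∎
      where
        open ≡-Reasoning
        regroup : ∀ a b c d → a * (b * c * d) ≡ a * b * (c * d)
        regroup = solve-∀

    mate-at : ∀ {x} → N x ≡ 1 → Σ[ p ∈ Fin 21 ] R x p ≡ 1 × N p ≡ 1 × (∀ G → mate G x ≡ G p)
    mate-at {x} Nx≡1 = p , Rxp , Np , λ G → trans (∑-single _ p (others G)) (at-p G)
      where
        common = positive-term (λ w → R v₀ w * R x w) (subst (0 <_) (sym (adjacent-codeg Nx≡1)) (s≤s z≤n))
        p : Fin 21
        p = proj₁ common
        Np×Rxp : N p ≡ 1 × R x p ≡ 1
        Np×Rxp = bits-product-positive (edge≤1 red v₀ p) (edge≤1 red x p) (proj₂ common)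
        Np = proj₁ Np×Rxp
        Rxp = proj₂ Np×Rxp
        others : ∀ G w → w ≢ p → R x w * N w * G w ≡ 0
        others G w w≢p = bits-product-zero (G w) (edge≤1 red x w) (edge≤1 red v₀ w)
          λ Rxw Nw → w≢p (common-neighbour-unique Nx≡1 Nw Rxw Np Rxp)
        at-p : ∀ G → R x p * N p * G p ≡ G p
        at-p G = trans (cong₂ (λ a b → a * b * G p) Rxp Np) (+-identityʳ (G p))

    picks-one : ∀ {y x} → M y ≡ 1 → N x ≡ 1 → R y x + mate (R y) x ≡ 1
    picks-one {y} {x} My≡1 = ∑-≡⇒pointwise-≡-on (edge≤1 red v₀) at-most-one total x
      where
        at-most-one : ∀ x → N x ≡ 1 → R y x + mate (R y) x ≤ 1
        at-most-one x Nx≡1 = subst (λ k → R y x + k ≤ 1) (sym (mate≡ (R y)))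
          (bits-not-both (edge≤1 red y x) (edge≤1 red y p) λ Ryx Ryp →
            M⇒≢v₀ My≡1 (common-neighbour-unique Rxp (trans (edge-sym red x v₀) Nx≡1) (trans (edge-sym red p v₀) Np)
                                                     (trans (edge-sym red x y) Ryx) (trans (edge-sym red p y) Ryp)))
          where
            p = proj₁ (mate-at Nx≡1)
            Rxp = proj₁ (proj₂ (mate-at Nx≡1))
            Np = proj₁ (proj₂ (proj₂ (mate-at Nx≡1)))
            mate≡ = proj₂ (proj₂ (proj₂ (mate-at Nx≡1)))
        total : ∑ (λ x → N x * (R y x + mate (R y) x)) ≡ ∑ (λ x → N x * 1)
        total = begin
          ∑ (λ x → N x * (R y x + mate (R y) x))
            ≡⟨ ∑-cong (λ x → *-distribˡ-+ (N x) (R y x) (mate (R y) x)) ⟩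
          ∑ (λ x → N x * R y x + N x * mate (R y) x)
            ≡⟨ ∑-distrib-+ (λ x → N x * R y x) (λ x → N x * mate (R y) x) ⟩
          ∑ (λ x → N x * R y x) + ∑ (λ x → N x * mate (R y) x)
            ≡⟨ cong (∑ (λ x → N x * R y x) +_) (∑-mate (R y)) ⟩
          ∑ (λ x → N x * R y x) + ∑ (λ x → N x * R y x)
            ≡⟨ cong₂ _+_ (N-degree My≡1) (N-degree My≡1) ⟩
          8
            ≡⟨ sym (regular v₀) ⟩
          ∑ N
            ≡⟨ ∑-cong (λ x → sym (*-identityʳ (N x))) ⟩
          ∑ (λ x → N x * 1) ∎
          where open ≡-Reasoning

    codegᴺ : Fin 21 → Fin 21 → ℕ
    codegᴺ a b = ∑ λ x → N x * (R a x * R b x)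

    codegᴹ : Fin 21 → Fin 21 → ℕ
    codegᴹ a b = ∑ λ w → M w * (R a w * R b w)

    codegᴺ≤codeg : ∀ a b → codegᴺ a b ≤ codeg red a b
    codegᴺ≤codeg a b = ∑-mono-≤ λ x → ≤-trans (*-monoˡ-≤ (R a x * R b x) (edge≤1 red v₀ x)) (≤-reflexive (+-identityʳ _))

    mate-of-neighbour : ∀ {y x} → M y ≡ 1 → N x ≡ 1 → R y x ≡ 1 → mate (R y) x ≡ 0
    mate-of-neighbour {y} {x} My≡1 Nx≡1 Ryx≡1 =
      +-cancelˡ-≡ 1 _ _ (trans (cong (_+ mate (R y) x) (sym Ryx≡1)) (picks-one My≡1 Nx≡1))

    codegᴹ-N-neighbour : ∀ {y x} → M y ≡ 1 → N x ≡ 1 → R y x ≡ 1 → codegᴹ y x ≡ 1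
    codegᴹ-N-neighbour {y} {x} My≡1 Nx≡1 Ryx≡1 = begin
      ∑ (λ w → M w * (R y w * R x w))
        ≡⟨ sym (cong₂ (λ a b → a + b + ∑ (λ w → M w * (R y w * R x w))) v₀-term N-part) ⟩
      R y v₀ * R x v₀ + ∑ (λ w → N w * (R y w * R x w)) + ∑ (λ w → M w * (R y w * R x w))
        ≡⟨ sym (∑-split v₀ (λ w → R y w * R x w)) ⟩
      codeg red y x
        ≡⟨ adjacent-codeg Ryx≡1 ⟩
      1 ∎
      where
        open ≡-Reasoning
        v₀-term : R y v₀ * R x v₀ ≡ 0
        v₀-term = cong (_* R x v₀) (M⇒R-v₀≡0 My≡1)
        regroup : ∀ a b c → a * (b * c) ≡ c * a * b
        regroup = solve-∀
        N-part : ∑ (λ w → N w * (R y w * R x w)) ≡ 0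
        N-part = trans (∑-cong λ w → regroup (N w) (R y w) (R x w)) (mate-of-neighbour My≡1 Nx≡1 Ryx≡1)

    codegᴺ-adjacent : ∀ {y y′} → M y ≡ 1 → M y′ ≡ 1 → R y y′ ≡ 1 → codegᴺ y y′ ≡ 1
    codegᴺ-adjacent {y} {y′} My≡1 My′≡1 Ryy′≡1 =
      ∑-≡⇒pointwise-≡-on (λ w → *-mono-≤ (edge≤1 blue v₀ w) (edge≤1 red y w)) codegᴺ≤1 total y′ (cong₂ _*_ My′≡1 Ryy′≡1)
      where
        open ≡-Reasoning
        codegᴺ≤1 : ∀ w → M w * R y w ≡ 1 → codegᴺ y w ≤ 1
        codegᴺ≤1 w MRyw≡1 = ≤-trans (codegᴺ≤codeg y w) (≤-reflexive (adjacent-codeg (m*n≡1⇒n≡1 (M w) (R y w) MRyw≡1)))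
        regroup : ∀ a b c d e → a * b * (c * (d * e)) ≡ c * d * (a * (b * e))
        regroup = solve-∀
        total : ∑ (λ w → M w * R y w * codegᴺ y w) ≡ ∑ (λ w → M w * R y w * 1)
        total = begin
          ∑ (λ w → M w * R y w * ∑ (λ x → N x * (R y x * R w x)))
            ≡⟨ ∑-cong (λ w → *-distribˡ-∑ (M w * R y w) (λ x → N x * (R y x * R w x))) ⟩
          ∑ (λ w → ∑ (λ x → M w * R y w * (N x * (R y x * R w x))))
            ≡⟨ ∑-comm (λ w x → M w * R y w * (N x * (R y x * R w x))) ⟩
          ∑ (λ x → ∑ (λ w → M w * R y w * (N x * (R y x * R w x))))
            ≡⟨ ∑-cong (λ x → ∑-cong (λ w → trans (regroup (M w) (R y w) (N x) (R y x) (R w x))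
                                                 (cong (λ r → N x * R y x * (M w * (R y w * r))) (edge-sym red w x)))) ⟩
          ∑ (λ x → ∑ (λ w → N x * R y x * (M w * (R y w * R x w))))
            ≡⟨ ∑-cong (λ x → sym (*-distribˡ-∑ (N x * R y x) (λ w → M w * (R y w * R x w)))) ⟩
          ∑ (λ x → N x * R y x * ∑ (λ w → M w * (R y w * R x w)))
            ≡⟨ ∑-cong (λ x → bit-*-cong (*-mono-≤ (edge≤1 red v₀ x) (edge≤1 red y x)) λ NRyx≡1 →
                 codegᴹ-N-neighbour My≡1 (m*n≡1⇒m≡1 (N x) (R y x) NRyx≡1) (m*n≡1⇒n≡1 (N x) (R y x) NRyx≡1)) ⟩
          ∑ (λ x → N x * R y x * 1)
            ≡⟨ ∑-cong (λ x → *-identityʳ (N x * R y x)) ⟩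
          ∑ (λ x → N x * R y x)
            ≡⟨ trans (N-degree My≡1) (sym (M-degree My≡1)) ⟩
          ∑ (λ w → M w * R y w)
            ≡⟨ ∑-cong (λ w → sym (*-identityʳ (M w * R y w))) ⟩
          ∑ (λ w → M w * R y w * 1) ∎

    codegᴺ-sym : ∀ a b → codegᴺ a b ≡ codegᴺ b a
    codegᴺ-sym a b = ∑-cong λ x → cong (N x *_) (*-comm (R a x) (R b x))

    ∑-over-matching : ∀ (g k : Fin 21 → ℕ) → (∀ x → N x ≡ 1 → g x + mate g x ≡ 1 + 2 * (k x + mate k x)) →
                      ∑ (λ x → N x * g x) ≡ 4 + 2 * ∑ (λ x → N x * k x)
    ∑-over-matching g k pair = halve (∑ (λ x → N x * g x)) K (begin
      ∑ (λ x → N x * g x) + ∑ (λ x → N x * g x)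
        ≡⟨ cong (∑ (λ x → N x * g x) +_) (sym (∑-mate g)) ⟩
      ∑ (λ x → N x * g x) + ∑ (λ x → N x * mate g x)
        ≡⟨ sym (∑-distrib-+ (λ x → N x * g x) (λ x → N x * mate g x)) ⟩
      ∑ (λ x → N x * g x + N x * mate g x)
        ≡⟨ ∑-cong (λ x → trans (sym (*-distribˡ-+ (N x) (g x) (mate g x))) (bit-*-cong (edge≤1 red v₀ x) (pair x))) ⟩
      ∑ (λ x → N x * (1 + 2 * (k x + mate k x)))
        ≡⟨ ∑-cong (λ x → spread (N x) (k x) (mate k x)) ⟩
      ∑ (λ x → N x + 2 * (N x * k x) + 2 * (N x * mate k x))
        ≡⟨ ∑-distrib-+₃ N (λ x → 2 * (N x * k x)) (λ x → 2 * (N x * mate k x)) ⟩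
      ∑ N + ∑ (λ x → 2 * (N x * k x)) + ∑ (λ x → 2 * (N x * mate k x))
        ≡⟨ cong₂ (λ a b → ∑ N + a + b) (sym (*-distribˡ-∑ 2 (λ x → N x * k x))) (sym (*-distribˡ-∑ 2 (λ x → N x * mate k x))) ⟩
      ∑ N + 2 * K + 2 * ∑ (λ x → N x * mate k x)
        ≡⟨ cong₂ (λ a b → a + 2 * K + 2 * b) (regular v₀) (∑-mate k) ⟩
      8 + 2 * K + 2 * K ∎)
      where
        open ≡-Reasoning
        K = ∑ (λ x → N x * k x)
        spread : ∀ n k m → n * (1 + 2 * (k + m)) ≡ n + 2 * (n * k) + 2 * (n * m)
        spread = solve-∀
        halve : ∀ x K → x + x ≡ 8 + 2 * K + 2 * K → x ≡ 4 + 2 * K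
        halve x K x+x≡ = *-cancelˡ-≡ x (4 + 2 * K) 2 (trans (double x) (trans x+x≡ (double′ K)))
          where
            double : ∀ x → 2 * x ≡ x + x
            double = solve-∀
            double′ : ∀ K → 8 + 2 * K + 2 * K ≡ 2 * (4 + 2 * K)
            double′ = solve-∀

    parity-identity : ∀ {y y′ u} → M y ≡ 1 → M y′ ≡ 1 → M u ≡ 1 →
      codegᴺ y u + codegᴺ y′ u + codegᴺ y y′ ≡ 4 + 2 * ∑ (λ x → N x * (R u x * (R y x * R y′ x)))
    parity-identity {y} {y′} {u} My≡1 My′≡1 Mu≡1 = trans (sym ∑Ng≡codegᴺ-sum) (∑-over-matching g k pair)
      where
        open ≡-Reasoning
        g k : Fin 21 → ℕ
        g x = R y x * R u x + R y′ x * R u x + R y x * R y′ x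
        k x = R u x * (R y x * R y′ x)
        distrib₃ : ∀ n a b c → n * (a + b + c) ≡ n * a + n * b + n * c
        distrib₃ = solve-∀
        ∑Ng≡codegᴺ-sum : ∑ (λ x → N x * g x) ≡ codegᴺ y u + codegᴺ y′ u + codegᴺ y y′
        ∑Ng≡codegᴺ-sum = trans (∑-cong λ x → distrib₃ (N x) (R y x * R u x) (R y′ x * R u x) (R y x * R y′ x))
          (∑-distrib-+₃ (λ x → N x * (R y x * R u x)) (λ x → N x * (R y′ x * R u x)) (λ x → N x * (R y x * R y′ x)))
        pair : ∀ x → N x ≡ 1 → g x + mate g x ≡ 1 + 2 * (k x + mate k x)
        pair x Nx≡1 = begin
          g x + mate g x              ≡⟨ cong (g x +_) (mate≡ g) ⟩
          g x + g p                   ≡⟨ pair-parity (edge≤1 red y x) (edge≤1 red y′ x) (edge≤1 red u x)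
                                           (picks-one′ My≡1) (picks-one′ My′≡1) (picks-one′ Mu≡1) ⟩
          1 + 2 * (k x + k p)         ≡⟨ cong (λ m → 1 + 2 * (k x + m)) (sym (mate≡ k)) ⟩
          1 + 2 * (k x + mate k x)    ∎
          where
            p = proj₁ (mate-at Nx≡1)
            mate≡ = proj₂ (proj₂ (proj₂ (mate-at Nx≡1)))
            picks-one′ : ∀ {z} → M z ≡ 1 → R z x + R z p ≡ 1
            picks-one′ {z} Mz≡1 = trans (cong (R z x +_) (sym (mate≡ (R z)))) (picks-one Mz≡1 Nx≡1)

    4≤codegᴺ-sum : ∀ {y y′ u} → M y ≡ 1 → M y′ ≡ 1 → M u ≡ 1 → 4 ≤ codegᴺ y u + codegᴺ y′ u + codegᴺ y y′
    4≤codegᴺ-sum My≡1 My′≡1 Mu≡1 = ≤-trans (m≤m+n 4 _) (≤-reflexive (sym (parity-identity My≡1 My′≡1 Mu≡1)))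

    codeg-split : ∀ {a} b → M a ≡ 1 → codeg red a b ≡ codegᴺ a b + codegᴹ a b
    codeg-split {a} b Ma≡1 = begin
      codeg red a b
        ≡⟨ ∑-split v₀ (λ w → R a w * R b w) ⟩
      R a v₀ * R b v₀ + codegᴺ a b + codegᴹ a b
        ≡⟨ cong (λ r → r * R b v₀ + codegᴺ a b + codegᴹ a b) (M⇒R-v₀≡0 Ma≡1) ⟩
      codegᴺ a b + codegᴹ a b ∎
      where open ≡-Reasoning

    codegᴹ≤2 : ∀ {u z} → M u ≡ 1 → M z ≡ 1 → u ≢ z → R u z ≡ 0 → codegᴹ u z ≤ 2
    codegᴹ≤2 {u} {z} Mu≡1 Mz≡1 u≢z Ruz≡0 with codegᴹ u z ≤? 2
    ... | yes codegᴹ≤2 = codegᴹ≤2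
    ... | no codegᴹ≰2 = contradiction (+-mono-≤ 2≤codegᴺ (≰⇒> codegᴹ≰2)) (<⇒≱ (s≤s (≤-reflexive codegᴺ+codegᴹ≡4)))
      where
        codegᴺ+codegᴹ≡4 : codegᴺ u z + codegᴹ u z ≡ 4
        codegᴺ+codegᴹ≡4 = trans (sym (codeg-split z Mu≡1)) (nonadjacent-codeg (R≡0⇒B≡1 u≢z Ruz≡0))
        common = positive-term (λ w → M w * (R u w * R z w)) (≤-trans (s≤s z≤n) (≰⇒> codegᴹ≰2))
        w = proj₁ common
        Mw×rest = bits-product-positive (edge≤1 blue v₀ w) (*-mono-≤ (edge≤1 red u w) (edge≤1 red z w)) (proj₂ common)
        Mw≡1 = proj₁ Mw×rest
        Ruw≡1 = m*n≡1⇒m≡1 (R u w) (R z w) (proj₂ Mw×rest)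
        Rzw≡1 = m*n≡1⇒n≡1 (R u w) (R z w) (proj₂ Mw×rest)
        2≤codegᴺ : 2 ≤ codegᴺ u z
        2≤codegᴺ = +-cancelˡ-≤ 2 2 (codegᴺ u z) (begin
          4
            ≤⟨ 4≤codegᴺ-sum Mw≡1 Mz≡1 Mu≡1 ⟩
          codegᴺ w u + codegᴺ z u + codegᴺ w z
            ≡⟨ cong₂ (λ a b → a + codegᴺ z u + b) (codegᴺ-adjacent Mw≡1 Mu≡1 (trans (edge-sym red w u) Ruw≡1))
                                                  (codegᴺ-adjacent Mw≡1 Mz≡1 (trans (edge-sym red w z) Rzw≡1)) ⟩
          1 + codegᴺ z u + 1
            ≡⟨ cong (λ x → 1 + x + 1) (codegᴺ-sym z u) ⟩
          1 + codegᴺ u z + 1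
            ≡⟨ regroup (codegᴺ u z) ⟩
          2 + codegᴺ u z ∎)
          where
            open ≤-Reasoning
            regroup : ∀ x → 1 + x + 1 ≡ 2 + x
            regroup = solve-∀

    ∑M≡12 : ∑ M ≡ 12
    ∑M≡12 = +-cancelˡ-≡ 9 _ _ (trans (cong (λ d → 1 + d + ∑ M) (sym (regular v₀))) (deg-red+deg-blue v₀))

    M-edge : Fin 21 → Fin 21 → ℕ
    M-edge y y′ = M y * M y′ * R y y′

    M-edge≤1 : ∀ y y′ → M-edge y y′ ≤ 1
    M-edge≤1 y y′ = *-mono-≤ (*-mono-≤ (edge≤1 blue v₀ y) (edge≤1 blue v₀ y′)) (edge≤1 red y y′)

    M-edge-sym : ∀ y y′ → M-edge y y′ ≡ M-edge y′ y
    M-edge-sym y y′ = cong₂ _*_ (*-comm (M y) (M y′)) (edge-sym red y y′)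

    row-sum : ∀ (f : Fin 21 → ℕ) → ∑ (λ y → ∑ (λ y′ → M-edge y y′ * f y)) ≡ 4 * ∑ (λ y → M y * f y)
    row-sum f = begin
      ∑ (λ y → ∑ (λ y′ → M y * M y′ * R y y′ * f y))
        ≡⟨ ∑-cong (λ y → trans (∑-cong λ y′ → regroup (M y) (M y′) (R y y′) (f y))
                                (sym (*-distribˡ-∑ (M y * f y) (λ y′ → M y′ * R y y′)))) ⟩
      ∑ (λ y → M y * f y * ∑ (λ y′ → M y′ * R y y′))
        ≡⟨ ∑-cong (λ y → trans (*-assoc (M y) (f y) (∑ (λ y′ → M y′ * R y y′))) (trans (bit-*-cong (edge≤1 blue v₀ y)
                                (λ My≡1 → cong (f y *_) (M-degree My≡1))) (regroup′ (M y) (f y)))) ⟩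
      ∑ (λ y → 4 * (M y * f y))
        ≡⟨ sym (*-distribˡ-∑ 4 (λ y → M y * f y)) ⟩
      4 * ∑ (λ y → M y * f y) ∎
      where
        open ≡-Reasoning
        regroup : ∀ a b r x → a * b * r * x ≡ a * x * (b * r)
        regroup = solve-∀
        regroup′ : ∀ a x → a * (x * 4) ≡ 4 * (a * x)
        regroup′ = solve-∀

    ∑-codegᴹ : ∀ {u} → M u ≡ 1 → ∑ (λ z → M z * codegᴹ u z) ≡ 16
    ∑-codegᴹ {u} Mu≡1 = begin
      ∑ (λ z → M z * ∑ (λ w → M w * (R u w * R z w)))
        ≡⟨ ∑-cong (λ z → *-distribˡ-∑ (M z) (λ w → M w * (R u w * R z w))) ⟩
      ∑ (λ z → ∑ (λ w → M z * (M w * (R u w * R z w))))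
        ≡⟨ ∑-comm (λ z w → M z * (M w * (R u w * R z w))) ⟩
      ∑ (λ w → ∑ (λ z → M z * (M w * (R u w * R z w))))
        ≡⟨ ∑-cong (λ w → ∑-cong λ z → trans (regroup (M z) (M w) (R u w) (R z w))
                                            (cong (λ r → M w * R u w * (M z * r)) (edge-sym red z w))) ⟩
      ∑ (λ w → ∑ (λ z → M w * R u w * (M z * R w z)))
        ≡⟨ ∑-cong (λ w → sym (*-distribˡ-∑ (M w * R u w) (λ z → M z * R w z))) ⟩
      ∑ (λ w → M w * R u w * ∑ (λ z → M z * R w z))
        ≡⟨ ∑-cong (λ w → bit-*-cong (*-mono-≤ (edge≤1 blue v₀ w) (edge≤1 red u w))
                          (λ MRuw≡1 → M-degree (m*n≡1⇒m≡1 (M w) (R u w) MRuw≡1))) ⟩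
      ∑ (λ w → M w * R u w * 4)
        ≡⟨ sym (*-distribʳ-∑ 4 (λ w → M w * R u w)) ⟩
      ∑ (λ w → M w * R u w) * 4
        ≡⟨ cong (_* 4) (M-degree Mu≡1) ⟩
      16 ∎
      where
        open ≡-Reasoning
        regroup : ∀ a b c d → a * (b * (c * d)) ≡ b * c * (a * d)
        regroup = solve-∀

    module Parity {u} (Mu≡1 : M u ≡ 1) where

      odd : Fin 21 → ℕ
      odd z = codegᴺ z u % 2

      odd≤1 : ∀ z → odd z ≤ 1
      odd≤1 z = s≤s⁻¹ (m%n<n (codegᴺ z u) 2)

      odd-flip : ∀ {y y′} → M y ≡ 1 → M y′ ≡ 1 → R y y′ ≡ 1 → odd y + odd y′ ≡ 1
      odd-flip {y} {y′} My≡1 My′≡1 Ryy′≡1 = odd-sum (codegᴺ y u) (codegᴺ y′ u) K (+-cancelʳ-≡ 1 _ _ (begin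
        codegᴺ y u + codegᴺ y′ u + 1             ≡⟨ cong (codegᴺ y u + codegᴺ y′ u +_) (sym (codegᴺ-adjacent My≡1 My′≡1 Ryy′≡1)) ⟩
        codegᴺ y u + codegᴺ y′ u + codegᴺ y y′   ≡⟨ parity-identity My≡1 My′≡1 Mu≡1 ⟩
        4 + 2 * K                                ≡⟨ shift K ⟩
        3 + 2 * K + 1                            ∎))
        where
          open ≡-Reasoning
          K = ∑ (λ x → N x * (R u x * (R y x * R y′ x)))
          shift : ∀ k → 4 + 2 * k ≡ 3 + 2 * k + 1
          shift = solve-∀

      odd-u : odd u ≡ 0
      odd-u = cong (_% 2) (trans (∑-cong λ x → cong (N x *_) (bit² (edge≤1 red u x))) (N-degree Mu≡1))

      odd-flip-edge : ∀ {y y′} → M-edge y y′ ≡ 1 → odd y + odd y′ ≡ 1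
      odd-flip-edge {y} {y′} E≡1 = odd-flip (m*n≡1⇒m≡1 (M y) (M y′) MM≡1) (m*n≡1⇒n≡1 (M y) (M y′) MM≡1)
                                            (m*n≡1⇒n≡1 (M y * M y′) (R y y′) E≡1)
        where MM≡1 = m*n≡1⇒m≡1 (M y * M y′) (R y y′) E≡1

      ∑-odd : ∑ (λ z → M z * odd z) ≡ 6
      ∑-odd = *-cancelˡ-≡ _ 6 8 (begin
        8 * ∑ (λ z → M z * odd z)
          ≡⟨ double (∑ (λ z → M z * odd z)) ⟩
        4 * ∑ (λ z → M z * odd z) + 4 * ∑ (λ z → M z * odd z)
          ≡⟨ sym (cong₂ _+_ (row-sum odd) (row-sum odd)) ⟩
        ∑ (λ y → ∑ (λ y′ → M-edge y y′ * odd y)) + ∑ (λ y → ∑ (λ y′ → M-edge y y′ * odd y))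
          ≡⟨ cong (∑ (λ y → ∑ (λ y′ → M-edge y y′ * odd y)) +_) (trans (∑-comm (λ y y′ → M-edge y y′ * odd y))
                (∑-cong λ y′ → ∑-cong λ y → cong (_* odd y) (M-edge-sym y y′))) ⟩
        ∑ (λ y → ∑ (λ y′ → M-edge y y′ * odd y)) + ∑ (λ y → ∑ (λ y′ → M-edge y y′ * odd y′))
          ≡⟨ sym (∑∑-distrib-+ (λ y y′ → M-edge y y′ * odd y) (λ y y′ → M-edge y y′ * odd y′)) ⟩
        ∑ (λ y → ∑ (λ y′ → M-edge y y′ * odd y + M-edge y y′ * odd y′))
          ≡⟨ ∑-cong (λ y → ∑-cong λ y′ → trans (sym (*-distribˡ-+ (M-edge y y′) (odd y) (odd y′)))
                (bit-*-cong (M-edge≤1 y y′) odd-flip-edge)) ⟩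
        ∑ (λ y → ∑ (λ y′ → M-edge y y′ * 1))
          ≡⟨ row-sum (λ _ → 1) ⟩
        4 * ∑ (λ y → M y * 1)
          ≡⟨ cong (4 *_) (trans (∑-cong λ y → *-identityʳ (M y)) ∑M≡12) ⟩
        8 * 6 ∎)
        where
          open ≡-Reasoning
          double : ∀ x → 8 * x ≡ 4 * x + 4 * x
          double = solve-∀

      odd⇒codegᴹ≡0 : ∀ {z} → M z ≡ 1 → odd z ≡ 1 → codegᴹ u z ≡ 0
      odd⇒codegᴹ≡0 {z} Mz≡1 odd-z≡1 = ∑-zero λ w →
        bits³-zero (edge≤1 blue v₀ w) (edge≤1 red u w) (edge≤1 red z w) λ Mw≡1 Ruw≡1 Rzw≡1 →
          0≢1+n (begin
            0                  ≡⟨ sym (+-cancelˡ-≡ 1 _ _ (trans (cong (_+ odd w) (sym odd-z≡1)) (odd-flip Mz≡1 Mw≡1 Rzw≡1))) ⟩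
            odd w              ≡⟨ sym (cong (_+ odd w) odd-u) ⟩
            odd u + odd w      ≡⟨ odd-flip Mu≡1 Mw≡1 Ruw≡1 ⟩
            1                  ∎)
        where open ≡-Reasoning

      codegᴹ-bound : ∀ z → M z ≡ 1 → codegᴹ u z + 2 * odd z ≤ 2 + 2 * δ u z
      codegᴹ-bound z Mz≡1 with u ≟ z
      ... | yes refl = ≤-reflexive (cong₂ (λ h o → h + 2 * o) codegᴹ-uu odd-u)
        where
          codegᴹ-uu : codegᴹ u u ≡ 4
          codegᴹ-uu = trans (∑-cong λ w → cong (M w *_) (bit² (edge≤1 red u w))) (M-degree Mu≡1)
      ... | no u≢z = bit-cases (λ o → codegᴹ u z + 2 * o ≤ 2) (odd≤1 z) even-case odd-case
        where
          even-case : odd z ≡ 0 → codegᴹ u z + 0 ≤ 2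
          even-case odd-z≡0 = ≤-trans (≤-reflexive (+-identityʳ (codegᴹ u z))) (codegᴹ≤2 Mu≡1 Mz≡1 u≢z Ruz≡0)
            where
              Ruz≡0 : R u z ≡ 0
              Ruz≡0 = bit-cases (λ r → r ≡ 0) (edge≤1 red u z) (λ _ → refl) λ Ruz≡1 →
                contradiction (trans (sym (cong₂ _+_ odd-u odd-z≡0)) (odd-flip Mu≡1 Mz≡1 Ruz≡1)) λ ()
          odd-case : odd z ≡ 1 → codegᴹ u z + 2 ≤ 2
          odd-case odd-z≡1 = ≤-reflexive (cong (_+ 2) (odd⇒codegᴹ≡0 Mz≡1 odd-z≡1))

      impossible : ⊥
      impossible = contradiction (begin
        28
          ≡⟨ cong₂ (λ h o → h + 2 * o) (sym (∑-codegᴹ Mu≡1)) (sym ∑-odd) ⟩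
        ∑ (λ z → M z * codegᴹ u z) + 2 * ∑ (λ z → M z * odd z)
          ≡⟨ cong (∑ (λ z → M z * codegᴹ u z) +_) (*-distribˡ-∑ 2 (λ z → M z * odd z)) ⟩
        ∑ (λ z → M z * codegᴹ u z) + ∑ (λ z → 2 * (M z * odd z))
          ≡⟨ sym (∑-distrib-+ (λ z → M z * codegᴹ u z) (λ z → 2 * (M z * odd z))) ⟩
        ∑ (λ z → M z * codegᴹ u z + 2 * (M z * odd z))
          ≡⟨ ∑-cong (λ z → regroup (M z) (codegᴹ u z) (odd z)) ⟩
        ∑ (λ z → M z * (codegᴹ u z + 2 * odd z))
          ≤⟨ ∑-mono-≤ (λ z → bit-*-mono (edge≤1 blue v₀ z) (codegᴹ-bound z)) ⟩
        ∑ (λ z → M z * (2 + 2 * δ u z))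
          ≡⟨ ∑-cong (λ z → regroup′ (M z) (δ u z)) ⟩
        ∑ (λ z → 2 * M z + 2 * (δ u z * M z))
          ≡⟨ ∑-linear 2 M (λ z → 2 * (δ u z * M z)) ⟩
        2 * ∑ M + ∑ (λ z → 2 * (δ u z * M z))
          ≡⟨ cong₂ (λ m x → 2 * m + x) ∑M≡12 (sym (*-distribˡ-∑ 2 (λ z → δ u z * M z))) ⟩
        24 + 2 * ∑ (λ z → δ u z * M z)
          ≡⟨ cong (λ m → 24 + 2 * m) (trans (∑-δ M u) Mu≡1) ⟩
        26 ∎) (from-no (28 ≤? 26))
        where
          open ≤-Reasoning
          regroup : ∀ m h o → m * h + 2 * (m * o) ≡ m * (h + 2 * o)
          regroup = solve-∀
          regroup′ : ∀ m d → m * (2 + 2 * d) ≡ 2 * m + 2 * (d * m)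
          regroup′ = solve-∀

    no-strongly-regular : ⊥
    no-strongly-regular = Parity.impossible Mu≡1
      where
        some-u = positive-term M (subst (0 <_) (sym ∑M≡12) (s≤s z≤n))
        u = proj₁ some-u
        Mu≡1 : M u ≡ 1
        Mu≡1 = ≤-antisym (edge≤1 blue v₀ u) (proj₂ some-u)

module UpperBound (c : Fin 21 → Fin 21 → Colour) (c-sym : Symmetric c) where
  open Colouring c c-sym

  red-or-blue-book : HasBook c red 2 ⊎ HasBook c blue 8
  red-or-blue-book with Finₚ.any? (λ a → Finₚ.any? λ b → R a b ≟ℕ 1 ×-dec 2 ≤? codeg red a b)
                      | Finₚ.any? (λ a → Finₚ.any? λ b → B a b ≟ℕ 1 ×-dec 8 ≤? codeg blue a b)
  ... | yes (_ , _ , Rab≡1 , 2≤codeg) | _ = inj₁ (codeg⇒book Rab≡1 2≤codeg)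
  ... | no _ | yes (_ , _ , Bab≡1 , 8≤codeg) = inj₂ (codeg⇒book Bab≡1 8≤codeg)
  ... | no no-red | no no-blue =
    ⊥-elim (NoStronglyRegular.no-strongly-regular c c-sym (BookFree₂₁.strongly-regular c c-sym red-sparse blue-sparse))
    where
      red-sparse : ∀ {a b} → R a b ≡ 1 → codeg red a b ≤ 1
      red-sparse {a} {b} Rab≡1 = s≤s⁻¹ (≰⇒> λ 2≤codeg → no-red (a , b , Rab≡1 , 2≤codeg))
      blue-sparse : ∀ {a b} → B a b ≡ 1 → codeg blue a b ≤ 7
      blue-sparse {a} {b} Bab≡1 = s≤s⁻¹ (≰⇒> λ 8≤codeg → no-blue (a , b , Bab≡1 , 8≤codeg))

BookArrows-21 : BookArrows 21 2 8
BookArrows-21 = UpperBound.red-or-blue-book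

mainTheorem3 : IsBookRamseyNumber 2 8 21
mainTheorem3 = BookArrows-21 , λ m m<21 → ¬BookArrows-20 ∘ BookArrows-mono (s≤s⁻¹ m<21)
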